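{- Let $H=\{H_a\}_{a\in\alpha}$ be an $\alpha$-family of subgroups of $\pi$. If two nanowords over $\alpha$ are homotopic, then their $H$-coverings are homotopic.
   Context: Fix a set $\alpha$ with involution $\tau$. An $\alpha$-alphabet is a set $\mathcal{A}$ with a map $A\mapsto|A|\in\alpha$. A nanoword is a pair $(\mathcal{A},w)$ with $\mathcal{A}$ a finite $\alpha$-alphabet and $w$ a word in $\mathcal{A}$ in which each letter occurs exactly twice. Homotopy of nanowords is generated by isomorphisms (bijections of alphabets preserving $|\cdot|$ carrying one word letterwise to the other) and the moves and inverses ($x,y,z,t$ words in the remaining letters): (1) $xAAy\mapsto xy$; (2) $xAByBAz\mapsto xyz$ if $|B|=\tau(|A|)$; (3) $xAByACzBCt\mapsto xBAyCAzCBt$ if $A,B,C$ distinct and $|A|=|B|=|C|$. Let $\pi$ be the multiplicative abelian group with generators $\{a\}_{a\in\alpha}$ and relations $a\,\tau(a)=1$. For $A,B\in\mathcal{A}$ let $n_w(A,B)=1$ if $w=\cdots A\cdots B\cdots A\cdots B\cdots$, $-1$ if $w=\cdots B\cdots A\cdots B\cdots A\cdots$, $0$ otherwise, and $[A]_w=\prod_{B\in\mathcal{A}}|B|^{n_w(A,B)}\in\pi$. An $\alpha$-family of subgroups of $\pi$ is a family $H=\{H_a\subset\pi\}_{a\in\alpha}$ of subgroups with $H_a=H_{\tau(a)}$ for all $a$. The $H$-covering of $(\mathcal{A},w)$ is the nanoword obtained by deleting from both $\mathcal{A}$ and $w$ all letters $A$ with $[A]_w\notin H_{|A|}$. -}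

module Defs where

open import Data.Bool using (Bool; true; false; not)
open import Data.Nat using (ℕ)
open import Data.Fin using (Fin; _≟_)
open import Data.List using (List; []; _∷_; _++_; map; filter; length; reverse; allFin; concatMap)
open import Data.List.Properties using (≡-dec)
open import Data.Product using (Σ; ∃; _×_; _,_)
open import Relation.Nullary using (¬_; yes; no)
open import Relation.Nullary.Decidable using (_⊎-dec_)
open import Relation.Binary.PropositionalEquality using (_≡_; _≢_)
open import Function.Definitions using (Injective)

-- Nanowords over an α-alphabet.
-- A finite α-alphabet is represented as Fin n together with a labelling
-- Fin n → α (this is no loss, since homotopy contains all isomorphisms).

record Nanoword (α : Set) : Set where
  field
    n     : ℕ
    label : Fin n → α
    word  : List (Fin n)
    twice : ∀ (A : Fin n) → length (filter (_≟ A) word) ≡ 2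
open Nanoword public

data Filtered {L : Set} (P : L → Set) : List L → List L → Set where
  f[]   : Filtered P [] []
  fkeep : ∀ {x xs ys} → P x → Filtered P xs ys → Filtered P (x ∷ xs) (x ∷ ys)
  fdrop : ∀ {x xs ys} → ¬ P x → Filtered P xs ys → Filtered P (x ∷ xs) ys

-- N' is (isomorphic to) the nanoword obtained from N by deleting from the
-- alphabet and the word all letters not satisfying P.
Restriction : {α : Set} (N : Nanoword α) (N' : Nanoword α) → (Fin (n N) → Set) → Set
Restriction N N' P =
  Σ (Fin (n N') → Fin (n N)) λ e →
    Injective _≡_ _≡_ e
    × (∀ B → label N (e B) ≡ label N' B)
    × (∀ A → P A → ∃ λ B → e B ≡ A)
    × Filtered P (word N) (map e (word N'))

Iso : {α : Set} → Nanoword α → Nanoword α → Set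
Iso N N' =
  Σ (Fin (n N') → Fin (n N)) λ e →
    Injective _≡_ _≡_ e
    × (∀ A → ∃ λ B → e B ≡ A)
    × (∀ B → label N (e B) ≡ label N' B)
    × map e (word N') ≡ word N

module _ {α : Set} (τ : α → α) where

  data Step (N N' : Nanoword α) : Set where
    iso   : Iso N N' → Step N N'
    move1 : (A : Fin (n N)) (x y : List (Fin (n N))) →
            word N ≡ x ++ A ∷ A ∷ y →
            Restriction N N' (λ C → C ≢ A) → Step N N'
    move2 : (A B : Fin (n N)) (x y z : List (Fin (n N))) →
            word N ≡ x ++ A ∷ B ∷ y ++ B ∷ A ∷ z →
            label N B ≡ τ (label N A) →
            Restriction N N' (λ C → C ≢ A × C ≢ B) → Step N N'
    move3 : (A B C : Fin (n N)) (x y z t : List (Fin (n N))) →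
            A ≢ B → A ≢ C → B ≢ C →
            label N A ≡ label N B → label N B ≡ label N C →
            word N ≡ x ++ A ∷ B ∷ y ++ A ∷ C ∷ z ++ B ∷ C ∷ t →
            (e : Fin (n N') → Fin (n N)) →
            Injective _≡_ _≡_ e → (∀ D → ∃ λ D' → e D' ≡ D) →
            (∀ D → label N (e D) ≡ label N' D) →
            map e (word N') ≡ x ++ B ∷ A ∷ y ++ C ∷ A ∷ z ++ C ∷ B ∷ t →
            Step N N'

  data Homotopic : Nanoword α → Nanoword α → Set where
    h-refl  : ∀ {N} → Homotopic N N
    h-step  : ∀ {N N'} → Step N N' → Homotopic N N'
    h-sym   : ∀ {N N'} → Homotopic N N' → Homotopic N' N
    h-trans : ∀ {N N' N''} → Homotopic N N' → Homotopic N' N'' → Homotopic N N''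

  -- The group π = ⟨ α | abelian, a τ(a) = 1 ⟩, presented by words of
  -- signed generators ((a , true) = a, (a , false) = a⁻¹) modulo the
  -- congruence generated by the defining relations.

  PiWord : Set
  PiWord = List (α × Bool)

  infix 4 _≈π_
  data _≈π_ : PiWord → PiWord → Set where
    π-refl  : ∀ {u} → u ≈π u
    π-sym   : ∀ {u v} → u ≈π v → v ≈π u
    π-trans : ∀ {u v w} → u ≈π v → v ≈π w → u ≈π w
    π-cong  : ∀ {u u' v v'} → u ≈π u' → v ≈π v' → u ++ v ≈π u' ++ v'
    π-comm  : ∀ g h → g ∷ h ∷ [] ≈π h ∷ g ∷ []
    π-invˡ  : ∀ a → (a , false) ∷ (a , true) ∷ [] ≈π []
    π-invʳ  : ∀ a → (a , true) ∷ (a , false) ∷ [] ≈π []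
    π-rel   : ∀ a → (a , true) ∷ (τ a , true) ∷ [] ≈π []

  πinv : PiWord → PiWord
  πinv u = reverse (map (λ { (a , s) → (a , not s) }) u)

  record Subgroup : Set₁ where
    field
      _∈H   : PiWord → Set
      resp  : ∀ {u v} → u ≈π v → u ∈H → v ∈H
      one   : [] ∈H
      mul   : ∀ {u v} → u ∈H → v ∈H → (u ++ v) ∈H
      inv   : ∀ {u} → u ∈H → πinv u ∈H
  open Subgroup public

  record AlphaFamily : Set₁ where
    field
      H     : α → Subgroup
      H-τ   : ∀ a u → _∈H (H a) u → _∈H (H (τ a)) u
      H-τ'  : ∀ a u → _∈H (H (τ a)) u → _∈H (H a) u
  open AlphaFamily public

patternAB : {m : ℕ} → Fin m → Fin m → List (Fin m) → List (Fin m)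
patternAB A B w = filter (λ C → (C ≟ A) ⊎-dec (C ≟ B)) w

-- |B|^{n_w(A,B)} as an element (word) of π.
contrib : {α : Set} (N : Nanoword α) → Fin (n N) → Fin (n N) → List (α × Bool)
contrib N A B with ≡-dec _≟_ (patternAB A B (word N)) (A ∷ B ∷ A ∷ B ∷ [])
... | yes _ = (label N B , true) ∷ []
... | no _ with ≡-dec _≟_ (patternAB A B (word N)) (B ∷ A ∷ B ∷ A ∷ [])
...   | yes _ = (label N B , false) ∷ []
...   | no _  = []

bracket : {α : Set} (N : Nanoword α) → Fin (n N) → List (α × Bool)
bracket N A = concatMap (contrib N A) (allFin (n N))

IsCovering : {α : Set} (τ : α → α) → AlphaFamily τ → Nanoword α → Nanoword α → Set
IsCovering τ Hf N C =
  Restriction N C (λ A → _∈H (H Hf (label N A)) (bracket N A))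

-- Restrict both nanowords of a homotopy step to the letters A with [A] ∈ H_{|A|}: the restricted step is
-- again a homotopy step (or an isomorphism), provided the kept letters correspond. They do, because
-- brackets are invariant: a surviving letter keeps its bracket in π (the letter of move (1) is linked with
-- nothing, and the letters A, B of move (2) contribute |A|^k τ(|A|)^k = 1), the two letters of move (2)
-- have equal brackets and labels related by τ, and in move (3) [B] = [A][C] with |A| = |B| = |C|, so the
-- kept part of {A, B, C} never has exactly two elements. Membership in H is not decidable, so the kept
-- letters of the intermediate nanowords of a homotopy are only chosen under a double negation; since the
-- existence of a compatible choice is decidable (there are finitely many), the double negation goes away.

module Submission where

open import Defs
open import Data.Bool using (Bool; true; false; not; _∧_; T; if_then_else_)
open import Data.Bool.Properties using (∧-comm) renaming (_≟_ to _≟ᵇ_)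
open import Data.Nat using (ℕ; zero; suc; _+_)
open import Data.Nat.Properties using (suc-injective; +-suc) renaming (_≟_ to _≟ℕ_)
open import Data.Nat.Tactic.RingSolver using (solve-∀)
open import Data.Fin using (Fin; _≟_) renaming (zero to fz; suc to fs)
open import Data.Fin.Properties using (all?) renaming (suc-injective to fs-injective)
open import Data.Vec using (Vec; lookup) renaming ([] to v[]; _∷_ to _v∷_)
open import Data.List using (List; []; _∷_; _++_; [_]; map; filter; filterᵇ; length; reverse; allFin; concatMap; replicate)
open import Data.List.Properties
open import Data.List.Membership.Propositional using (_∈_)
open import Data.List.Membership.Propositional.Properties using (∈-map⁺; ∈-++⁺ʳ)
open import Data.List.Relation.Unary.Any using (here; there)
open import Data.List.Relation.Unary.All using (All; []; _∷_) renaming (lookup to All-lookup)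
open import Data.Product using (Σ; ∃; _×_; _,_; proj₁; proj₂)
open import Data.Product.Properties using () renaming (≡-dec to ×-≡-dec)
open import Data.Sum using (_⊎_; inj₁; inj₂)
open import Data.Empty using (⊥; ⊥-elim)
open import Relation.Nullary using (¬_; yes; no; Dec; does)
open import Relation.Nullary.Decidable using (_⊎-dec_; _×-dec_; T?)
open import Relation.Unary using (Decidable)
open import Relation.Binary.PropositionalEquality hiding (resp; [_])
open import Function.Definitions using (Injective)
open import Function.Base using (_∘_)

-- The group π

module PiGroup {α : Set} (τ : α → α) where

  infix 4 _≈_
  _≈_ : PiWord τ → PiWord τ → Set
  _≈_ = _≈π_ τ

  infixr 5 _⨾_
  _⨾_ : ∀ {u v w} → u ≈ v → v ≈ w → u ≈ w
  _⨾_ = π-trans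

  ≡⇒≈ : ∀ {u v} → u ≡ v → u ≈ v
  ≡⇒≈ refl = π-refl

  ++-congˡ : ∀ u {v v'} → v ≈ v' → u ++ v ≈ u ++ v'
  ++-congˡ u p = π-cong (π-refl {u = u}) p

  ++-congʳ : ∀ {u u'} v → u ≈ u' → u ++ v ≈ u' ++ v
  ++-congʳ v p = π-cong p (π-refl {u = v})

  ++-assoc-≈ : ∀ u v w → (u ++ v) ++ w ≈ u ++ (v ++ w)
  ++-assoc-≈ u v w = ≡⇒≈ (++-assoc u v w)

  ++-trivialʳ : ∀ u {v} → v ≈ [] → u ++ v ≈ u
  ++-trivialʳ u p = ++-congˡ u p ⨾ ≡⇒≈ (++-identityʳ u)

  ∷-comm : ∀ g v → g ∷ v ≈ v ++ [ g ]
  ∷-comm g [] = π-refl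
  ∷-comm g (h ∷ v) = π-cong (π-comm g h) (π-refl {u = v}) ⨾ ++-congˡ [ h ] (∷-comm g v)

  ++-comm-≈ : ∀ u v → u ++ v ≈ v ++ u
  ++-comm-≈ [] v = ≡⇒≈ (sym (++-identityʳ v))
  ++-comm-≈ (g ∷ u) v =
    ++-congˡ [ g ] (++-comm-≈ u v) ⨾ ∷-comm g (v ++ u) ⨾ ≡⇒≈ (++-assoc v u [ g ])
    ⨾ ++-congˡ v (π-sym (∷-comm g u))

  cancel-pair : ∀ g h u v → g ∷ h ∷ [] ≈ [] → g ∷ (u ++ h ∷ v) ≈ u ++ v
  cancel-pair g h u v gh =
    ++-comm-≈ [ g ] (u ++ h ∷ v) ⨾ ++-assoc-≈ u (h ∷ v) [ g ]
    ⨾ ++-congˡ u (++-comm-≈ (h ∷ v) [ g ] ⨾ ++-congʳ v gh)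

  invert : α × Bool → α × Bool
  invert (a , s) = (a , not s)

  invert-inverseˡ : ∀ g → invert g ∷ g ∷ [] ≈ []
  invert-inverseˡ (a , true) = π-invˡ a
  invert-inverseˡ (a , false) = π-invʳ a

  invert-inverseʳ : ∀ g → g ∷ invert g ∷ [] ≈ []
  invert-inverseʳ g = ++-comm-≈ [ g ] [ invert g ] ⨾ invert-inverseˡ g

  πinv-inverseˡ : ∀ u → πinv τ u ++ u ≈ []
  πinv-inverseˡ [] = π-refl
  πinv-inverseˡ (g ∷ u) =
    ≡⇒≈ (cong (_++ g ∷ u) (unfold-reverse (invert g) (map invert u)))
    ⨾ ++-assoc-≈ (reverse (map invert u)) [ invert g ] (g ∷ u)
    ⨾ ++-congˡ (reverse (map invert u)) (π-cong (invert-inverseˡ g) (π-refl {u = u}))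
    ⨾ πinv-inverseˡ u

  π-rel⁻¹ : ∀ a → (a , false) ∷ (τ a , false) ∷ [] ≈ []
  π-rel⁻¹ a =
    π-sym (++-trivialʳ ((a , false) ∷ (τ a , false) ∷ []) (π-rel a))
    ⨾ ++-congˡ [ (a , false) ] (++-comm-≈ [ (τ a , false) ] ((a , true) ∷ (τ a , true) ∷ []))
    ⨾ π-cong (invert-inverseˡ (a , true)) (π-refl {u = (τ a , true) ∷ (τ a , false) ∷ []})
    ⨾ invert-inverseʳ (τ a , true)

  concatMap-cong-≈ : {A : Set} (f g : A → PiWord τ) (l : List A) → (∀ x → f x ≈ g x) →
                     concatMap f l ≈ concatMap g l
  concatMap-cong-≈ f g [] h = π-refl
  concatMap-cong-≈ f g (x ∷ l) h = π-cong (h x) (concatMap-cong-≈ f g l h)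

  concatMap-++-≈ : {A : Set} (f g : A → PiWord τ) (l : List A) →
                   concatMap (λ x → f x ++ g x) l ≈ concatMap f l ++ concatMap g l
  concatMap-++-≈ f g [] = π-refl
  concatMap-++-≈ f g (x ∷ l) =
    ++-assoc-≈ (f x) (g x) _
    ⨾ ++-congˡ (f x) (++-congˡ (g x) (concatMap-++-≈ f g l) ⨾ π-sym (++-assoc-≈ (g x) (concatMap f l) (concatMap g l))
                      ⨾ ++-congʳ (concatMap g l) (++-comm-≈ (g x) (concatMap f l)) ⨾ ++-assoc-≈ (concatMap f l) (g x) (concatMap g l))
    ⨾ π-sym (++-assoc-≈ (f x) (concatMap f l) _)

count : {m : ℕ} → Fin m → List (Fin m) → ℕ
count y l = length (filter (_≟ y) l)

count-here : {m : ℕ} (y : Fin m) (l : List (Fin m)) → count y (y ∷ l) ≡ suc (count y l)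
count-here y l = cong length (filter-accept (_≟ y) {x = y} {xs = l} refl)

count-there : {m : ℕ} {x y : Fin m} (l : List (Fin m)) → x ≢ y → count y (x ∷ l) ≡ count y l
count-there {x = x} {y} l ne = cong length (filter-reject (_≟ y) {x = x} {xs = l} ne)

count-++ : {m : ℕ} (y : Fin m) (u v : List (Fin m)) → count y (u ++ v) ≡ count y u + count y v
count-++ y u v = trans (cong length (filter-++ (_≟ y) u v)) (length-++ (filter (_≟ y) u))

count≢0⇒split : {m : ℕ} (x : Fin m) (l : List (Fin m)) {k : ℕ} → count x l ≡ suc k →
                Σ (List (Fin m)) λ ys → Σ (List (Fin m)) λ zs → l ≡ ys ++ x ∷ zs
count≢0⇒split x [] ()
count≢0⇒split x (y ∷ l) eq with y ≟ x
... | yes refl = [] , l , refl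
... | no ne with count≢0⇒split x l eq
...   | ys , zs , e = y ∷ ys , zs , cong (y ∷_) e

count-map-injective : {m k : ℕ} {e : Fin k → Fin m} → Injective _≡_ _≡_ e → (x : Fin k) (l : List (Fin k)) →
                      count (e x) (map e l) ≡ count x l
count-map-injective inj x [] = refl
count-map-injective {e = e} inj x (y ∷ l) with x ≟ y
... | yes refl = trans (count-here (e x) (map e l)) (trans (cong suc (count-map-injective inj x l)) (sym (count-here x l)))
... | no ne = trans (count-there (map e l) (λ q → ne (sym (inj q))))
                (trans (count-map-injective inj x l) (sym (count-there l (λ q → ne (sym q)))))

count-map-outside : {m k : ℕ} (e : Fin k → Fin m) (x : Fin m) → (∀ b → e b ≢ x) → (l : List (Fin k)) →
                    count x (map e l) ≡ 0
count-map-outside e x ne [] = refl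
count-map-outside e x ne (y ∷ l) = trans (count-there (map e l) (ne y)) (count-map-outside e x ne l)

allFin-suc : (n : ℕ) → allFin (suc n) ≡ fz ∷ map fs (allFin n)
allFin-suc n = cong (fz ∷_) (sym (map-tabulate (λ i → i) fs))

count-allFin : (n : ℕ) (x : Fin n) → count x (allFin n) ≡ 1
count-allFin (suc n) fz =
  trans (cong (count fz) (allFin-suc n))
    (trans (count-here fz (map fs (allFin n))) (cong suc (count-map-outside fs fz (λ b ()) (allFin n))))
count-allFin (suc n) (fs x) =
  trans (cong (count (fs x)) (allFin-suc n))
    (trans (count-there {x = fz} (map fs (allFin n)) (λ ()))
      (trans (count-map-injective fs-injective x (allFin n)) (count-allFin n x)))

module Products {α : Set} (τ : α → α) where
  open PiGroup τ

  concatMap-sameCount : {m : ℕ} (f : Fin m → PiWord τ) (l₁ l₂ : List (Fin m)) →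
                        (∀ x → count x l₁ ≡ count x l₂) → concatMap f l₁ ≈ concatMap f l₂
  concatMap-sameCount f [] [] h = π-refl
  concatMap-sameCount f [] (y ∷ l₂) h with () ← trans (h y) (count-here y l₂)
  concatMap-sameCount f (x ∷ l₁) l₂ h with count≢0⇒split x l₂ (trans (sym (h x)) (count-here x l₁))
  ... | ys , zs , refl =
    ++-congˡ (f x) (concatMap-sameCount f l₁ (ys ++ zs) counts-rest)
    ⨾ ++-congˡ (f x) (≡⇒≈ (concatMap-++ f ys zs))
    ⨾ π-sym (++-assoc-≈ (f x) (concatMap f ys) (concatMap f zs))
    ⨾ ++-congʳ (concatMap f zs) (++-comm-≈ (f x) (concatMap f ys))
    ⨾ ++-assoc-≈ (concatMap f ys) (f x) (concatMap f zs)
    ⨾ ≡⇒≈ (sym (concatMap-++ f ys (x ∷ zs)))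
    where
    counts-rest : ∀ y → count y l₁ ≡ count y (ys ++ zs)
    counts-rest y with x ≟ y
    ... | yes refl = suc-injective (begin
      suc (count y l₁)          ≡⟨ trans (sym (count-here y l₁)) (h y) ⟩
      count y (ys ++ y ∷ zs)    ≡⟨ trans (count-++ y ys (y ∷ zs)) (cong (count y ys +_) (count-here y zs)) ⟩
      count y ys + suc (count y zs) ≡⟨ trans (+-suc (count y ys) (count y zs)) (cong suc (sym (count-++ y ys zs))) ⟩
      suc (count y (ys ++ zs))  ∎)
      where open ≡-Reasoning
    ... | no ne = begin
      count y l₁                ≡⟨ trans (sym (count-there l₁ ne)) (h y) ⟩
      count y (ys ++ x ∷ zs)    ≡⟨ trans (count-++ y ys (x ∷ zs)) (cong (count y ys +_) (count-there zs ne)) ⟩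
      count y ys + count y zs   ≡⟨ sym (count-++ y ys zs) ⟩
      count y (ys ++ zs)        ∎
      where open ≡-Reasoning

  concatMap-filterᵇ-cong-≈ : {m : ℕ} (d : Fin m → Bool) (f g : Fin m → PiWord τ) (l : List (Fin m)) →
                             (∀ x → d x ≡ true → f x ≈ g x) → concatMap f (filterᵇ d l) ≈ concatMap g (filterᵇ d l)
  concatMap-filterᵇ-cong-≈ d f g [] h = π-refl
  concatMap-filterᵇ-cong-≈ d f g (x ∷ l) h with d x in dx
  ... | true = π-cong (h x dx) (concatMap-filterᵇ-cong-≈ d f g l h)
  ... | false = concatMap-filterᵇ-cong-≈ d f g l h

false≢true : false ≢ true
false≢true ()

∧-true⁻ˡ : ∀ {a b} → a ∧ b ≡ true → a ≡ true
∧-true⁻ˡ {true} p = refl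

∧-true⁻ʳ : ∀ {a b} → a ∧ b ≡ true → b ≡ true
∧-true⁻ʳ {true} p = p

∧-true⁻₃ : ∀ {a b c} → a ∧ (b ∧ c) ≡ true → a ≡ true × b ≡ true × c ≡ true
∧-true⁻₃ {true} {true} {true} _ = refl , refl , refl

notExactlyTwo : Bool → Bool → Bool → Bool
notExactlyTwo true true false = false
notExactlyTwo true false true = false
notExactlyTwo false true true = false
notExactlyTwo _ _ _ = true

atMostOneTrue : ∀ {a b c} → notExactlyTwo a b c ≡ true → a ∧ (b ∧ c) ≡ false →
                ¬ (T a × T b) × ¬ (T a × T c) × ¬ (T b × T c)
atMostOneTrue {true} {true} {true} _ ()
atMostOneTrue {true} {false} {false} _ _ = (λ ()) , (λ ()) , (λ ())
atMostOneTrue {false} {true} {false} _ _ = (λ ()) , (λ ()) , (λ ())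
atMostOneTrue {false} {false} {true} _ _ = (λ ()) , (λ ()) , (λ ())
atMostOneTrue {false} {false} {false} _ _ = (λ ()) , (λ ()) , (λ ())

filterᵇ-accept : {A : Set} (d : A → Bool) {x : A} (xs : List A) → d x ≡ true → filterᵇ d (x ∷ xs) ≡ x ∷ filterᵇ d xs
filterᵇ-accept d xs p rewrite p = refl

filterᵇ-reject : {A : Set} (d : A → Bool) {x : A} (xs : List A) → d x ≡ false → filterᵇ d (x ∷ xs) ≡ filterᵇ d xs
filterᵇ-reject d xs p rewrite p = refl

filterᵇ-cong : {m : ℕ} {d d' : Fin m → Bool} → (∀ x → d x ≡ d' x) → (l : List (Fin m)) → filterᵇ d l ≡ filterᵇ d' l
filterᵇ-cong h [] = refl
filterᵇ-cong {d = d} {d'} h (x ∷ l) rewrite h x with d' x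
... | true = cong (x ∷_) (filterᵇ-cong h l)
... | false = filterᵇ-cong h l

filterᵇ-filterᵇ : {m : ℕ} (d d' : Fin m → Bool) (l : List (Fin m)) → filterᵇ d (filterᵇ d' l) ≡ filterᵇ (λ x → d' x ∧ d x) l
filterᵇ-filterᵇ d d' [] = refl
filterᵇ-filterᵇ d d' (x ∷ l) with d' x
... | false = filterᵇ-filterᵇ d d' l
... | true with d x
...   | true = cong (x ∷_) (filterᵇ-filterᵇ d d' l)
...   | false = filterᵇ-filterᵇ d d' l

map-filterᵇ : {m k : ℕ} (e : Fin k → Fin m) (d : Fin m → Bool) (d' : Fin k → Bool) →
              (∀ b → d' b ≡ d (e b)) → (l : List (Fin k)) → map e (filterᵇ d' l) ≡ filterᵇ d (map e l)
map-filterᵇ e d d' h [] = refl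
map-filterᵇ e d d' h (x ∷ l) rewrite h x with d (e x)
... | true = cong (e x ∷_) (map-filterᵇ e d d' h l)
... | false = map-filterᵇ e d d' h l

Filtered⇒filterᵇ : {m : ℕ} (d : Fin m → Bool) {w w' : List (Fin m)} → Filtered (λ x → d x ≡ true) w w' → w' ≡ filterᵇ d w
Filtered⇒filterᵇ d f[] = refl
Filtered⇒filterᵇ d (fkeep {x = x} p r) rewrite p = cong (x ∷_) (Filtered⇒filterᵇ d r)
Filtered⇒filterᵇ d (fdrop {x = x} p r) with d x
... | true = ⊥-elim (p refl)
... | false = Filtered⇒filterᵇ d r

filterᵇ-Filtered : {m : ℕ} (d : Fin m → Bool) (w : List (Fin m)) → Filtered (λ x → d x ≡ true) w (filterᵇ d w)
filterᵇ-Filtered d [] = f[]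
filterᵇ-Filtered d (x ∷ w) with d x in eq
... | true = fkeep eq (filterᵇ-Filtered d w)
... | false = fdrop (λ p → false≢true (trans (sym eq) p)) (filterᵇ-Filtered d w)

Filtered-decisions : {m : ℕ} {P : Fin m → Set} {w w' : List (Fin m)} → Filtered P w w' → All (λ x → Dec (P x)) w
Filtered-decisions f[] = []
Filtered-decisions (fkeep p r) = yes p ∷ Filtered-decisions r
Filtered-decisions (fdrop p r) = no p ∷ Filtered-decisions r

Filtered-kept : {m : ℕ} {P : Fin m → Set} {w w' : List (Fin m)} → Filtered P w w' → ∀ {x} → x ∈ w' → P x
Filtered-kept (fkeep p r) (here refl) = p
Filtered-kept (fkeep p r) (there q) = Filtered-kept r q
Filtered-kept (fdrop p r) q = Filtered-kept r q

Filtered-cong : {m : ℕ} {P Q : Fin m → Set} → (∀ x → P x → Q x) → (∀ x → Q x → P x) →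
                ∀ {w w'} → Filtered P w w' → Filtered Q w w'
Filtered-cong pq qp f[] = f[]
Filtered-cong pq qp (fkeep p r) = fkeep (pq _ p) (Filtered-cong pq qp r)
Filtered-cong pq qp (fdrop p r) = fdrop (λ q → p (qp _ q)) (Filtered-cong pq qp r)

letter-occurs : {α : Set} (N : Nanoword α) (X : Fin (n N)) → X ∈ word N
letter-occurs N X with count≢0⇒split X (word N) (twice N X)
... | ys , zs , eq rewrite eq = ∈-++⁺ʳ ys (here refl)

isNot : {m : ℕ} → Fin m → Fin m → Bool
isNot A X = not (does (X ≟ A))

isNot-true : {m : ℕ} (A X : Fin m) → X ≢ A → isNot A X ≡ true
isNot-true A X ne with X ≟ A
... | yes p = ⊥-elim (ne p)
... | no _ = refl

isNot-self : {m : ℕ} (A : Fin m) → isNot A A ≡ false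
isNot-self A with A ≟ A
... | yes _ = refl
... | no ne = ⊥-elim (ne refl)

isNot-true⁻ : {m : ℕ} (A X : Fin m) → isNot A X ≡ true → X ≢ A
isNot-true⁻ A X eq refl = false≢true (trans (sym (isNot-self A)) eq)

-- Sub-nanowords

RestrictionBy : {α : Set} (N : Nanoword α) → Nanoword α → (Fin (n N) → Bool) → Set
RestrictionBy N C d = Restriction N C (λ X → d X ≡ true)

Restriction-cong : {α : Set} {N C : Nanoword α} {P Q : Fin (n N) → Set} → (∀ x → P x → Q x) → (∀ x → Q x → P x) →
                   Restriction N C P → Restriction N C Q
Restriction-cong pq qp (e , inj , lab , sur , fl) = e , inj , lab , (λ A q → sur A (qp A q)) , Filtered-cong pq qp fl

Restriction-image : {α : Set} {N C : Nanoword α} {P : Fin (n N) → Set} (r : Restriction N C P) → ∀ B → P (proj₁ r B)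
Restriction-image {C = C} (e , inj , lab , sur , fl) B = Filtered-kept fl (∈-map⁺ e (letter-occurs C B))

Restriction-word : {α : Set} {N C : Nanoword α} (d : Fin (n N) → Bool) (r : RestrictionBy N C d) →
                   map (proj₁ r) (word C) ≡ filterᵇ d (word N)
Restriction-word d (e , inj , lab , sur , fl) = Filtered⇒filterᵇ d fl

record Embedding {α : Set} (N C : Nanoword α) (g : Fin (n N) → Bool) : Set where
  field
    em       : Fin (n C) → Fin (n N)
    em-inj   : Injective _≡_ _≡_ em
    em-label : ∀ B → label N (em B) ≡ label C B
    em-image : ∀ B → g (em B) ≡ true
    em-onto  : ∀ X → g X ≡ true → Σ (Fin (n C)) λ B → em B ≡ X
open Embedding public

Restriction⇒Embedding : {α : Set} {N C : Nanoword α} (d : Fin (n N) → Bool) → RestrictionBy N C d → Embedding N C d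
Restriction⇒Embedding {N = N} {C} d r@(e , inj , lab , sur , fl) =
  record { em = e ; em-inj = inj ; em-label = lab ; em-image = Restriction-image {N = N} {C} r ; em-onto = sur }

Iso⇒Embedding : {α : Set} {N N' : Nanoword α} → Iso N N' → Embedding N N' (λ _ → true)
Iso⇒Embedding (e , inj , sur , lab , w) =
  record { em = e ; em-inj = inj ; em-label = lab ; em-image = λ _ → refl ; em-onto = λ X _ → sur X }

Embedding-cong : {α : Set} {N C : Nanoword α} {g g' : Fin (n N) → Bool} → (∀ x → g x ≡ g' x) → Embedding N C g → Embedding N C g'
Embedding-cong h E = record
  { em = em E ; em-inj = em-inj E ; em-label = em-label E
  ; em-image = λ B → trans (sym (h _)) (em-image E B) ; em-onto = λ X p → em-onto E X (trans (h X) p) }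

Embedding-∘ : {α : Set} {N M C : Nanoword α} {q : Fin (n N) → Bool} {d : Fin (n M) → Bool} (h : Fin (n N) → Bool) →
              (E : Embedding N M q) → Embedding M C d → (∀ b → d b ≡ h (em E b)) → Embedding N C (λ X → q X ∧ h X)
Embedding-∘ {q = q} h E F hd = record
  { em = λ B → em E (em F B)
  ; em-inj = λ eq → em-inj F (em-inj E eq)
  ; em-label = λ B → trans (em-label E (em F B)) (em-label F B)
  ; em-image = image
  ; em-onto = onto }
  where
  image : ∀ B → q (em E (em F B)) ∧ h (em E (em F B)) ≡ true
  image B rewrite em-image E (em F B) = trans (sym (hd (em F B))) (em-image F B)
  onto : ∀ X → q X ∧ h X ≡ true → Σ _ λ B → em E (em F B) ≡ X
  onto X p with em-onto E X (∧-true⁻ˡ p)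
  ... | b , refl with em-onto F b (trans (hd b) (∧-true⁻ʳ {q (em E b)} p))
  ...   | B , refl = B , refl

Embedding-transfer : {α : Set} {N C C' : Nanoword α} {g : Fin (n N) → Bool} (E : Embedding N C g) (E' : Embedding N C' g) →
                     (w : List (Fin (n C))) → map (em E') (word C') ≡ map (em E) w →
                     Σ (Fin (n C') → Fin (n C)) λ f → Injective _≡_ _≡_ f × (∀ A → Σ _ λ B → f B ≡ A)
                       × (∀ B → label C (f B) ≡ label C' B) × map f (word C') ≡ w
Embedding-transfer {N = N} {C} {C'} E E' w weq =
  f , f-inj , f-onto , f-label , map-injective (em-inj E) (trans (sym (map-∘ (word C'))) (trans (map-cong f-em (word C')) weq))
  where
  f : Fin (n C') → Fin (n C)
  f B = proj₁ (em-onto E (em E' B) (em-image E' B))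
  f-em : ∀ B → em E (f B) ≡ em E' B
  f-em B = proj₂ (em-onto E (em E' B) (em-image E' B))
  f-inj : Injective _≡_ _≡_ f
  f-inj {a} {b} eq = em-inj E' (trans (sym (f-em a)) (trans (cong (em E) eq) (f-em b)))
  f-onto : ∀ A → Σ _ λ B → f B ≡ A
  f-onto A with em-onto E' (em E A) (em-image E A)
  ... | B , eB = B , em-inj E (trans (f-em B) eB)
  f-label : ∀ B → label C (f B) ≡ label C' B
  f-label B = trans (sym (em-label E (f B))) (trans (cong (label N) (f-em B)) (em-label E' B))

sucIf : Bool → ℕ → ℕ
sucIf true k = suc k
sucIf false k = k

#true : {m : ℕ} → (Fin m → Bool) → ℕ
#true {zero} d = 0
#true {suc m} d = sucIf (d fz) (#true (d ∘ fs))

liftIf : (b : Bool) {k m : ℕ} → (Fin k → Fin m) → Fin (sucIf b k) → Fin (suc m)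
liftIf true g fz = fz
liftIf true g (fs i) = fs (g i)
liftIf false g i = fs (g i)

inclusion : {m : ℕ} (d : Fin m → Bool) → Fin (#true d) → Fin m
inclusion {zero} d ()
inclusion {suc m} d = liftIf (d fz) (inclusion (d ∘ fs))

index : {m : ℕ} (d : Fin m → Bool) (X : Fin m) → d X ≡ true → Fin (#true d)
index {suc m} d fz p with d fz
... | true = fz
index {suc m} d (fs X) p with d fz
... | true = fs (index (d ∘ fs) X p)
... | false = index (d ∘ fs) X p

inclusion-index : {m : ℕ} (d : Fin m → Bool) (X : Fin m) (p : d X ≡ true) → inclusion d (index d X p) ≡ X
inclusion-index {suc m} d fz p with d fz
... | true = refl
inclusion-index {suc m} d (fs X) p with d fz
... | true = cong fs (inclusion-index (d ∘ fs) X p)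
... | false = cong fs (inclusion-index (d ∘ fs) X p)

inclusion-injective : {m : ℕ} (d : Fin m → Bool) → Injective _≡_ _≡_ (inclusion d)
inclusion-injective {suc m} d = liftIf-injective (d fz)
  where
  liftIf-injective : (b : Bool) → Injective _≡_ _≡_ (liftIf b (inclusion (d ∘ fs)))
  liftIf-injective true {fz} {fz} eq = refl
  liftIf-injective true {fz} {fs j} ()
  liftIf-injective true {fs i} {fz} ()
  liftIf-injective true {fs i} {fs j} eq = cong fs (inclusion-injective (d ∘ fs) (fs-injective eq))
  liftIf-injective false eq = inclusion-injective (d ∘ fs) (fs-injective eq)

inclusion-image : {m : ℕ} (d : Fin m → Bool) (i : Fin (#true d)) → d (inclusion d i) ≡ true
inclusion-image {suc m} d with d fz in eq
... | true = λ { fz → eq ; (fs i) → inclusion-image (d ∘ fs) i }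
... | false = inclusion-image (d ∘ fs)

keepIf : {m : ℕ} (d : Fin m → Bool) (X : Fin m) (b : Bool) → d X ≡ b → List (Fin (#true d)) → List (Fin (#true d))
keepIf d X true eq r = index d X eq ∷ r
keepIf d X false eq r = r

restrictedWord : {m : ℕ} (d : Fin m → Bool) → List (Fin m) → List (Fin (#true d))
restrictedWord d [] = []
restrictedWord d (X ∷ w) = keepIf d X (d X) refl (restrictedWord d w)

map-inclusion-restrictedWord : {m : ℕ} (d : Fin m → Bool) (w : List (Fin m)) →
                               map (inclusion d) (restrictedWord d w) ≡ filterᵇ d w
map-inclusion-restrictedWord d [] = refl
map-inclusion-restrictedWord d (X ∷ w) = keepIf-map (d X) refl
  where
  keepIf-map : (b : Bool) (eq : d X ≡ b) → map (inclusion d) (keepIf d X b eq (restrictedWord d w)) ≡ filterᵇ d (X ∷ w)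
  keepIf-map true eq =
    trans (cong₂ _∷_ (inclusion-index d X eq) (map-inclusion-restrictedWord d w)) (sym (filterᵇ-accept d w eq))
  keepIf-map false eq = trans (map-inclusion-restrictedWord d w) (sym (filterᵇ-reject d w eq))

count-filterᵇ : {m : ℕ} (d : Fin m → Bool) (X : Fin m) → d X ≡ true → (w : List (Fin m)) →
                count X (filterᵇ d w) ≡ count X w
count-filterᵇ d X p [] = refl
count-filterᵇ d X p (Y ∷ w) with X ≟ Y
... | yes refl rewrite p = trans (count-here X (filterᵇ d w)) (trans (cong suc (count-filterᵇ d X p w)) (sym (count-here X w)))
... | no ne with d Y
...   | true = trans (count-there (filterᵇ d w) (λ q → ne (sym q)))
                 (trans (count-filterᵇ d X p w) (sym (count-there w (λ q → ne (sym q)))))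
...   | false = trans (count-filterᵇ d X p w) (sym (count-there w (λ q → ne (sym q))))

restrictedWord-twice : {α : Set} (N : Nanoword α) (d : Fin (n N) → Bool) (i : Fin (#true d)) →
                       count i (restrictedWord d (word N)) ≡ 2
restrictedWord-twice N d i = begin
  count i w'                                     ≡⟨ sym (count-map-injective (inclusion-injective d) i w') ⟩
  count (inclusion d i) (map (inclusion d) w')   ≡⟨ cong (count (inclusion d i)) (map-inclusion-restrictedWord d (word N)) ⟩
  count (inclusion d i) (filterᵇ d (word N))     ≡⟨ count-filterᵇ d (inclusion d i) (inclusion-image d i) (word N) ⟩
  count (inclusion d i) (word N)                 ≡⟨ twice N (inclusion d i) ⟩
  2                                              ∎
  where open ≡-Reasoning
        w' = restrictedWord d (word N)

restrict : {α : Set} (N : Nanoword α) (d : Fin (n N) → Bool) → Nanoword α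
restrict N d = record
  { n = #true d
  ; label = λ i → label N (inclusion d i)
  ; word = restrictedWord d (word N)
  ; twice = restrictedWord-twice N d }

restrict-restriction : {α : Set} (N : Nanoword α) (d : Fin (n N) → Bool) → RestrictionBy N (restrict N d) d
restrict-restriction N d =
  inclusion d , inclusion-injective d , (λ B → refl) , (λ A p → index d A p , inclusion-index d A p) ,
  subst (Filtered (λ X → d X ≡ true) (word N)) (sym (map-inclusion-restrictedWord d (word N))) (filterᵇ-Filtered d (word N))

-- Projecting homotopies onto sub-nanowords

move3-before move3-after : {X : Set} → List X → List X → List X → List X → X → X → X → List X
move3-before x y z t a b c = x ++ a ∷ b ∷ y ++ a ∷ c ∷ z ++ b ∷ c ∷ t
move3-after x y z t a b c = x ++ b ∷ a ∷ y ++ c ∷ a ∷ z ++ c ∷ b ∷ t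

map-move3-after : {X Y : Set} (f : X → Y) (x y z t : List X) (a b c : X) →
                  map f (move3-after x y z t a b c) ≡ move3-after (map f x) (map f y) (map f z) (map f t) (f a) (f b) (f c)
map-move3-after f x y z t a b c
  rewrite map-++ f x (b ∷ a ∷ y ++ c ∷ a ∷ z ++ c ∷ b ∷ t) | map-++ f y (c ∷ a ∷ z ++ c ∷ b ∷ t) | map-++ f z (c ∷ b ∷ t) = refl

move3-after-cong : {X : Set} {x y z t x' y' z' t' : List X} {a b c a' b' c' : X} →
                   x ≡ x' → y ≡ y' → z ≡ z' → t ≡ t' → a ≡ a' → b ≡ b' → c ≡ c' →
                   move3-after x y z t a b c ≡ move3-after x' y' z' t' a' b' c'
move3-after-cong refl refl refl refl refl refl refl = refl

map-∷∷⁻ : {A B : Set} (f : A → B) {u : List A} (x : List B) {a b : B} {v : List B} → map f u ≡ x ++ a ∷ b ∷ v →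
          Σ (List A) λ u₁ → Σ A λ a' → Σ A λ b' → Σ (List A) λ u₂ →
            u ≡ u₁ ++ a' ∷ b' ∷ u₂ × map f u₁ ≡ x × f a' ≡ a × f b' ≡ b × map f u₂ ≡ v
map-∷∷⁻ f {u} [] eq with u | eq
... | a' ∷ b' ∷ u₂ | refl = [] , a' , b' , u₂ , refl , refl , refl , refl , refl
map-∷∷⁻ f {x' ∷ u} (y ∷ x) eq with map-∷∷⁻ f {u} x (∷-injectiveʳ eq)
... | u₁ , a' , b' , u₂ , refl , e₁ , ea , eb , e₂ = x' ∷ u₁ , a' , b' , u₂ , refl , cong₂ _∷_ (∷-injectiveˡ eq) e₁ , ea , eb , e₂

filterᵇ-keptPair : {A : Set} (d : A → Bool) (x : List A) {p q : A} (y : List A) → d p ≡ true → d q ≡ true →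
                   filterᵇ d (x ++ p ∷ q ∷ y) ≡ filterᵇ d x ++ p ∷ q ∷ filterᵇ d y
filterᵇ-keptPair d x {p} {q} y dp dq rewrite filter-++ (T? ∘ d) x (p ∷ q ∷ y) | dp | dq = refl

filterᵇ-move3-before : {A : Set} (d : A → Bool) (x y z t : List A) {a b c : A} → d a ≡ true → d b ≡ true → d c ≡ true →
                       filterᵇ d (move3-before x y z t a b c) ≡ move3-before (filterᵇ d x) (filterᵇ d y) (filterᵇ d z) (filterᵇ d t) a b c
filterᵇ-move3-before d x y z t {a} {b} {c} da db dc =
  trans (filterᵇ-keptPair d x (y ++ a ∷ c ∷ z ++ b ∷ c ∷ t) da db) (cong (λ l → filterᵇ d x ++ a ∷ b ∷ l)
    (trans (filterᵇ-keptPair d y (z ++ b ∷ c ∷ t) da dc) (cong (λ l → filterᵇ d y ++ a ∷ c ∷ l) (filterᵇ-keptPair d z t db dc))))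

filterᵇ-move3-after : {A : Set} (d : A → Bool) (x y z t : List A) {a b c : A} → d a ≡ true → d b ≡ true → d c ≡ true →
                      filterᵇ d (move3-after x y z t a b c) ≡ move3-after (filterᵇ d x) (filterᵇ d y) (filterᵇ d z) (filterᵇ d t) a b c
filterᵇ-move3-after d x y z t {a} {b} {c} da db dc =
  trans (filterᵇ-keptPair d x (y ++ c ∷ a ∷ z ++ c ∷ b ∷ t) db da) (cong (λ l → filterᵇ d x ++ b ∷ a ∷ l)
    (trans (filterᵇ-keptPair d y (z ++ c ∷ b ∷ t) dc da) (cong (λ l → filterᵇ d y ++ c ∷ a ∷ l) (filterᵇ-keptPair d z t dc db))))

filterᵇ-afterRestriction : {m k : ℕ} (e : Fin k → Fin m) (q d : Fin m → Bool) (w : List (Fin m)) (w' : List (Fin k)) →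
                           map e w' ≡ filterᵇ q w → (∀ X → q X ∧ d X ≡ d X) → filterᵇ d (map e w') ≡ filterᵇ d w
filterᵇ-afterRestriction e q d w w' eq qd = trans (cong (filterᵇ d) eq) (trans (filterᵇ-filterᵇ d q w) (filterᵇ-cong qd w))

filter-swap : {A : Set} {P : A → Set} (P? : Decidable P) (x : List A) {p q : A} (y : List A) → ¬ (P p × P q) →
              filter P? (x ++ p ∷ q ∷ y) ≡ filter P? (x ++ q ∷ p ∷ y)
filter-swap {P = P} P? x {p} {q} y npq rewrite filter-++ P? x (p ∷ q ∷ y) | filter-++ P? x (q ∷ p ∷ y) = cong (filter P? x ++_) (swap (P? p) (P? q))
  where
  swap : Dec (P p) → Dec (P q) → filter P? (p ∷ q ∷ y) ≡ filter P? (q ∷ p ∷ y)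
  swap (yes pp) (yes pq) = ⊥-elim (npq (pp , pq))
  swap (yes pp) (no pq) = trans (filter-accept P? pp) (trans (cong (p ∷_) (filter-reject P? pq))
                           (sym (trans (filter-reject P? pq) (filter-accept P? pp))))
  swap (no pp) (yes pq) = trans (filter-reject P? pp) (trans (filter-accept P? pq)
                           (sym (trans (filter-accept P? pq) (cong (q ∷_) (filter-reject P? pp)))))
  swap (no pp) (no pq) = trans (filter-reject P? pp) (trans (filter-reject P? pq)
                           (sym (trans (filter-reject P? pq) (filter-reject P? pp))))

-- Move (3) is three transpositions of adjacent letters, each involving two of a, b, c.
filter-move3 : {A : Set} {P : A → Set} (P? : Decidable P) (x y z t : List A) {a b c : A} →
               ¬ (P a × P b) → ¬ (P a × P c) → ¬ (P b × P c) →
               filter P? (move3-before x y z t a b c) ≡ filter P? (move3-after x y z t a b c)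
filter-move3 P? x y z t {a} {b} {c} nab nac nbc = begin
  filter P? (x ++ a ∷ b ∷ y ++ a ∷ c ∷ z ++ b ∷ c ∷ t)       ≡⟨ filter-swap P? x (y ++ a ∷ c ∷ z ++ b ∷ c ∷ t) nab ⟩
  filter P? (x ++ b ∷ a ∷ y ++ a ∷ c ∷ z ++ b ∷ c ∷ t)       ≡⟨ cong (filter P?) (sym (++-assoc x (b ∷ a ∷ y) _)) ⟩
  filter P? ((x ++ b ∷ a ∷ y) ++ a ∷ c ∷ z ++ b ∷ c ∷ t)     ≡⟨ filter-swap P? (x ++ b ∷ a ∷ y) (z ++ b ∷ c ∷ t) nac ⟩
  filter P? ((x ++ b ∷ a ∷ y) ++ c ∷ a ∷ z ++ b ∷ c ∷ t)     ≡⟨ cong (filter P?) (trans (++-assoc x (b ∷ a ∷ y) _) (sym (reassoc (b ∷ c ∷ t)))) ⟩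
  filter P? ((x ++ b ∷ a ∷ y ++ c ∷ a ∷ z) ++ b ∷ c ∷ t)     ≡⟨ filter-swap P? (x ++ b ∷ a ∷ y ++ c ∷ a ∷ z) t nbc ⟩
  filter P? ((x ++ b ∷ a ∷ y ++ c ∷ a ∷ z) ++ c ∷ b ∷ t)     ≡⟨ cong (filter P?) (reassoc (c ∷ b ∷ t)) ⟩
  filter P? (x ++ b ∷ a ∷ y ++ c ∷ a ∷ z ++ c ∷ b ∷ t)       ∎
  where
  open ≡-Reasoning
  reassoc : ∀ w → (x ++ b ∷ a ∷ y ++ c ∷ a ∷ z) ++ w ≡ x ++ b ∷ a ∷ y ++ c ∷ a ∷ z ++ w
  reassoc w = trans (++-assoc x (b ∷ a ∷ y ++ c ∷ a ∷ z) w) (cong (λ l → x ++ b ∷ a ∷ l) (++-assoc y (c ∷ a ∷ z) w))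

isNot-injective : {m k : ℕ} (e : Fin k → Fin m) → Injective _≡_ _≡_ e → (A' : Fin k) (A : Fin m) → e A' ≡ A →
                  ∀ b → isNot A' b ≡ isNot A (e b)
isNot-injective e inj A' A eA b with b ≟ A' | e b ≟ A
... | yes p | yes q = refl
... | yes refl | no q = ⊥-elim (q eA)
... | no p | yes q = ⊥-elim (p (inj (trans q (sym eA))))
... | no p | no q = refl

isNot-restriction : {α : Set} {N N' : Nanoword α} {A : Fin (n N)} →
                    Restriction N N' (λ X → X ≢ A) → RestrictionBy N N' (isNot A)
isNot-restriction {N = N} {N'} {A} = Restriction-cong {N = N} {N'} (λ X p → isNot-true A X p) (λ X p → isNot-true⁻ A X p)

isNot₂-restriction : {α : Set} {N N' : Nanoword α} {A B : Fin (n N)} →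
                     Restriction N N' (λ X → X ≢ A × X ≢ B) → RestrictionBy N N' (λ X → isNot A X ∧ isNot B X)
isNot₂-restriction {N = N} {N'} {A} {B} = Restriction-cong {N = N} {N'} (λ X p → cong₂ _∧_ (isNot-true A X (proj₁ p)) (isNot-true B X (proj₂ p)))
                                                  (λ X p → isNot-true⁻ A X (∧-true⁻ˡ p) , isNot-true⁻ B X (∧-true⁻ʳ p))

Iso-sameRestriction : {α : Set} {N N' M M' : Nanoword α} {q d : Fin (n N) → Bool} {d' : Fin (n N') → Bool}
                      (E : Embedding N N' q) → (∀ b → d' b ≡ d (em E b)) → (∀ X → q X ∧ d X ≡ d X) →
                      filterᵇ d (map (em E) (word N')) ≡ filterᵇ d (word N) →
                      RestrictionBy N M d → RestrictionBy N' M' d' → Iso M M'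
Iso-sameRestriction {N = N} {N'} {M} {M'} {q} {d} {d'} E compat qd weq rM rM' =
  Embedding-transfer {N = N} {M} {M'} EM EM' (word M) (trans wM' (sym (Restriction-word {N = N} {M} d rM)))
  where
  EM : Embedding N M d
  EM = Restriction⇒Embedding {N = N} {M} d rM
  EM' : Embedding N M' d
  EM' = Embedding-cong qd (Embedding-∘ {N = N} {N'} {M'} d E (Restriction⇒Embedding {N = N'} {M'} d' rM') compat)
  wM' : map (em EM') (word M') ≡ filterᵇ d (word N)
  wM' = trans (map-∘ (word M')) (trans (cong (map (em E)) (Restriction-word {N = N'} {M'} d' rM'))
          (trans (map-filterᵇ (em E) d d' compat (word N')) weq))

-- D deletes from M = N|d the letters outside q, so it is N|(d ∧ q), as is M' = N'|d' with N' = N|q.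
Iso-restrictionOfRestriction :
  {α : Set} {N N' M M' D : Nanoword α} {q d : Fin (n N) → Bool} {d' : Fin (n N') → Bool}
  (rN' : RestrictionBy N N' q) → (∀ b → d' b ≡ d (proj₁ rN' b)) →
  (rM : RestrictionBy N M d) → RestrictionBy N' M' d' → (h : Fin (n M) → Bool) → RestrictionBy M D h →
  (∀ b → h b ≡ q (proj₁ rM b)) → Iso D M'
Iso-restrictionOfRestriction {N = N} {N'} {M} {M'} {D} {q} {d} {d'} rN' compat rM rM' h rD hq =
  Embedding-transfer {N = N} {D} {M'} ED EM' (word D) (trans wM' (sym wD))
  where
  E : Embedding N N' q
  E = Restriction⇒Embedding {N = N} {N'} q rN'
  EM : Embedding N M d
  EM = Restriction⇒Embedding {N = N} {M} d rM
  ED : Embedding N D (λ X → d X ∧ q X)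
  ED = Embedding-∘ {N = N} {M} {D} q EM (Restriction⇒Embedding {N = M} {D} h rD) hq
  EM' : Embedding N M' (λ X → d X ∧ q X)
  EM' = Embedding-cong (λ X → ∧-comm (q X) (d X)) (Embedding-∘ {N = N} {N'} {M'} d E (Restriction⇒Embedding {N = N'} {M'} d' rM') compat)
  wD : map (em ED) (word D) ≡ filterᵇ (λ X → d X ∧ q X) (word N)
  wD = trans (map-∘ (word D)) (trans (cong (map (em EM)) (Restriction-word {N = M} {D} h rD))
         (trans (map-filterᵇ (em EM) q h hq (word M)) (trans (cong (filterᵇ q) (Restriction-word {N = N} {M} d rM))
         (filterᵇ-filterᵇ q d (word N)))))
  wM' : map (em EM') (word M') ≡ filterᵇ (λ X → d X ∧ q X) (word N)
  wM' = trans (map-∘ (word M')) (trans (cong (map (em E)) (Restriction-word {N = N'} {M'} d' rM'))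
          (trans (map-filterᵇ (em E) d d' compat (word N')) (trans (cong (filterᵇ d) (Restriction-word {N = N} {N'} q rN'))
          (trans (filterᵇ-filterᵇ d q (word N)) (filterᵇ-cong (λ X → ∧-comm (q X) (d X)) (word N))))))

Iso-deletedUnkept : {α : Set} {N N' M M' : Nanoword α} {q d : Fin (n N) → Bool} {d' : Fin (n N') → Bool}
                    (rN' : RestrictionBy N N' q) → (∀ b → d' b ≡ d (proj₁ rN' b)) → (∀ X → q X ∧ d X ≡ d X) →
                    RestrictionBy N M d → RestrictionBy N' M' d' → Iso M M'
Iso-deletedUnkept {N = N} {N'} {M} {M'} {q} {d} rN' compat qd =
  Iso-sameRestriction {N = N} {N'} {M} {M'} (Restriction⇒Embedding {N = N} {N'} q rN') compat qd
    (filterᵇ-afterRestriction (proj₁ rN') q d (word N) (word N') (Restriction-word {N = N} {N'} q rN') qd)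

module Projection {α : Set} (τ : α → α) where

  Compatible : {N N' : Nanoword α} → Step τ N N' → (Fin (n N) → Bool) → (Fin (n N') → Bool) → Set
  Compatible (iso (e , _)) d d' = ∀ B → d' B ≡ d (e B)
  Compatible (move1 A x y _ (e , _)) d d' = ∀ B → d' B ≡ d (e B)
  Compatible (move2 A B x y z _ _ (e , _)) d d' = (∀ B' → d' B' ≡ d (e B')) × d A ≡ d B
  Compatible (move3 A B C x y z t _ _ _ _ _ _ e _ _ _ _) d d' =
    (∀ B' → d' B' ≡ d (e B')) × notExactlyTwo (d A) (d B) (d C) ≡ true

  project-move1 : {N N' M M' : Nanoword α} (A : Fin (n N)) (x y : List (Fin (n N))) → word N ≡ x ++ A ∷ A ∷ y →
                  (rN' : RestrictionBy N N' (isNot A)) {d : Fin (n N) → Bool} {d' : Fin (n N') → Bool} →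
                  (∀ B → d' B ≡ d (proj₁ rN' B)) → RestrictionBy N M d → RestrictionBy N' M' d' → Homotopic τ M M'
  project-move1 {N} {N'} {M} {M'} A x y wEq rN' {d} compat rM rM' with d A in dA
  ... | false = h-step (iso (Iso-deletedUnkept {N = N} {N'} {M} {M'} rN' compat unkept rM rM'))
    where
    unkept : ∀ X → isNot A X ∧ d X ≡ d X
    unkept X with X ≟ A
    ... | yes refl = sym dA
    ... | no _ = refl
  ... | true with map-∷∷⁻ (proj₁ rM) (filterᵇ d x)
                    (trans (Restriction-word {N = N} {M} d rM) (trans (cong (filterᵇ d) wEq) (filterᵇ-keptPair d x y dA dA)))
  ...   | u₁ , a , a' , u₂ , refl , _ , ea , ea' , _ with proj₁ (proj₂ rM) (trans ea (sym ea'))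
  ...     | refl =
    h-trans {N' = D} (h-step (move1 a u₁ u₂ refl (Restriction-cong {N = M} {D} (λ X p → isNot-true⁻ a X p) (λ X p → isNot-true a X p) rD)))
                     (h-step (iso (Iso-restrictionOfRestriction {N = N} {N'} {M} {M'} {D} rN' compat rM rM' (isNot a) rD
                                    (isNot-injective (proj₁ rM) (proj₁ (proj₂ rM)) a A ea))))
    where
    D = restrict M (isNot a)
    rD = restrict-restriction M (isNot a)

  project-move2 : {N N' M M' : Nanoword α} (A B : Fin (n N)) (x y z : List (Fin (n N))) →
                  word N ≡ x ++ A ∷ B ∷ y ++ B ∷ A ∷ z → label N B ≡ τ (label N A) →
                  (rN' : RestrictionBy N N' (λ X → isNot A X ∧ isNot B X)) {d : Fin (n N) → Bool} {d' : Fin (n N') → Bool} →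
                  (∀ B' → d' B' ≡ d (proj₁ rN' B')) → d A ≡ d B →
                  RestrictionBy N M d → RestrictionBy N' M' d' → Homotopic τ M M'
  project-move2 {N} {N'} {M} {M'} A B x y z wEq lAB rN' {d} compat dAB rM rM' with d A in dA
  ... | false = h-step (iso (Iso-deletedUnkept {N = N} {N'} {M} {M'} rN' compat unkept rM rM'))
    where
    unkept : ∀ X → (isNot A X ∧ isNot B X) ∧ d X ≡ d X
    unkept X with X ≟ A | X ≟ B
    ... | yes refl | _ = sym dA
    ... | no _ | yes refl = dAB
    ... | no _ | no _ = refl
  ... | true with map-∷∷⁻ (proj₁ rM) (filterᵇ d x)
                    (trans (Restriction-word {N = N} {M} d rM) (trans (cong (filterᵇ d) wEq)
                      (trans (filterᵇ-keptPair d x (y ++ B ∷ A ∷ z) dA (sym dAB))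
                        (cong (λ l → filterᵇ d x ++ A ∷ B ∷ l) (filterᵇ-keptPair d y z (sym dAB) dA)))))
  ...   | u₁ , a , b , u₂ , refl , _ , ea , eb , e₂ with map-∷∷⁻ (proj₁ rM) (filterᵇ d y) e₂
  ...     | v₁ , b' , a' , v₂ , refl , _ , eb' , ea' , _
              with proj₁ (proj₂ rM) (trans ea (sym ea')) | proj₁ (proj₂ rM) (trans eb (sym eb'))
  ...       | refl | refl =
    h-trans {N' = D} (h-step (move2 a b u₁ v₁ v₂ refl labM
                        (Restriction-cong {N = M} {D} (λ X p → isNot-true⁻ a X (∧-true⁻ˡ p) , isNot-true⁻ b X (∧-true⁻ʳ p))
                                                      (λ X p → cong₂ _∧_ (isNot-true a X (proj₁ p)) (isNot-true b X (proj₂ p))) rD)))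
                     (h-step (iso (Iso-restrictionOfRestriction {N = N} {N'} {M} {M'} {D} rN' compat rM rM' h rD
                       (λ X → cong₂ _∧_ (isNot-injective eM (proj₁ (proj₂ rM)) a A ea X) (isNot-injective eM (proj₁ (proj₂ rM)) b B eb X)))))
    where
    eM = proj₁ rM
    h : Fin (n M) → Bool
    h X = isNot a X ∧ isNot b X
    D = restrict M h
    rD = restrict-restriction M h
    labM : label M b ≡ τ (label M a)
    labM = trans (sym (proj₁ (proj₂ (proj₂ rM)) b)) (trans (cong (label N) eb) (trans lAB
             (cong τ (trans (cong (label N) (sym ea)) (proj₁ (proj₂ (proj₂ rM)) a)))))

  project-move3-allKept : {N N' M M' : Nanoword α} (A B C : Fin (n N)) (x y z t : List (Fin (n N))) →
                          A ≢ B → A ≢ C → B ≢ C → label N A ≡ label N B → label N B ≡ label N C →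
                          word N ≡ move3-before x y z t A B C →
                          (E : Embedding N N' (λ _ → true)) → map (em E) (word N') ≡ move3-after x y z t A B C →
                          {d : Fin (n N) → Bool} {d' : Fin (n N') → Bool} →
                          (∀ B' → d' B' ≡ d (em E B')) →
                          d A ≡ true → d B ≡ true → d C ≡ true →
                          RestrictionBy N M d → RestrictionBy N' M' d' → Homotopic τ M M'
  project-move3-allKept {N} {N'} {M} {M'} A B C x y z t nAB nAC nBC lAB lBC wEq E we {d} {d'} compat dA dB dC rM rM'
    with map-∷∷⁻ (proj₁ rM) (filterᵇ d x)
           (trans (Restriction-word {N = N} {M} d rM) (trans (cong (filterᵇ d) wEq) (filterᵇ-move3-before d x y z t dA dB dC)))
  ... | u₁ , a , b , u₂ , refl , e₁ , ea , eb , e₂ with map-∷∷⁻ (proj₁ rM) (filterᵇ d y) e₂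
  ...   | v₁ , a' , c , v₂ , refl , f₁ , ea' , ec , f₂ with map-∷∷⁻ (proj₁ rM) (filterᵇ d z) f₂
  ...     | w₁ , b' , c' , t₁ , refl , g₁ , eb' , ec' , g₂
                with proj₁ (proj₂ rM) (trans ea (sym ea')) | proj₁ (proj₂ rM) (trans eb (sym eb'))
                   | proj₁ (proj₂ rM) (trans ec (sym ec'))
  ...       | refl | refl | refl with Embedding-transfer {N = N} {M} {M'} EM EM' (move3-after u₁ v₁ w₁ t₁ a b c) word-M'
    where
    eM = proj₁ rM
    EM = Restriction⇒Embedding {N = N} {M} d rM
    EM' = Embedding-∘ {N = N} {N'} {M'} d E (Restriction⇒Embedding {N = N'} {M'} d' rM') compat
    word-M' : map (em EM') (word M') ≡ map eM (move3-after u₁ v₁ w₁ t₁ a b c)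
    word-M' = begin
      map (em EM') (word M')                       ≡⟨ map-∘ (word M') ⟩
      map (em E) (map (proj₁ rM') (word M'))       ≡⟨ cong (map (em E)) (Restriction-word {N = N'} {M'} d' rM') ⟩
      map (em E) (filterᵇ d' (word N'))            ≡⟨ map-filterᵇ (em E) d d' compat (word N') ⟩
      filterᵇ d (map (em E) (word N'))             ≡⟨ cong (filterᵇ d) we ⟩
      filterᵇ d (move3-after x y z t A B C)        ≡⟨ filterᵇ-move3-after d x y z t dA dB dC ⟩
      move3-after (filterᵇ d x) (filterᵇ d y) (filterᵇ d z) (filterᵇ d t) A B C
        ≡⟨ sym (trans (map-move3-after eM u₁ v₁ w₁ t₁ a b c) (move3-after-cong e₁ f₁ g₁ g₂ ea eb ec)) ⟩
      map eM (move3-after u₁ v₁ w₁ t₁ a b c)       ∎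
      where open ≡-Reasoning
  ...         | f , f-inj , f-onto , f-label , word-f =
    h-step (move3 a b c u₁ v₁ w₁ t₁ (λ p → nAB (trans (sym ea) (trans (cong eM p) eb)))
      (λ p → nAC (trans (sym ea) (trans (cong eM p) ec))) (λ p → nBC (trans (sym eb) (trans (cong eM p) ec)))
      (labels ea eb lAB) (labels eb ec lBC) refl f f-inj f-onto f-label word-f)
    where
    eM = proj₁ rM
    labels : ∀ {p q P Q} → eM p ≡ P → eM q ≡ Q → label N P ≡ label N Q → label M p ≡ label M q
    labels {p} {q} ep eq lPQ = trans (sym (proj₁ (proj₂ (proj₂ rM)) p))
      (trans (cong (label N) ep) (trans lPQ (trans (cong (label N) (sym eq)) (proj₁ (proj₂ (proj₂ rM)) q))))

  project-move3 : {N N' M M' : Nanoword α} (A B C : Fin (n N)) (x y z t : List (Fin (n N))) →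
                  A ≢ B → A ≢ C → B ≢ C → label N A ≡ label N B → label N B ≡ label N C →
                  word N ≡ move3-before x y z t A B C →
                  (E : Embedding N N' (λ _ → true)) → map (em E) (word N') ≡ move3-after x y z t A B C →
                  {d : Fin (n N) → Bool} {d' : Fin (n N') → Bool} →
                  (∀ B' → d' B' ≡ d (em E B')) → notExactlyTwo (d A) (d B) (d C) ≡ true →
                  RestrictionBy N M d → RestrictionBy N' M' d' → Homotopic τ M M'
  project-move3 {N} {N'} {M} {M'} A B C x y z t nAB nAC nBC lAB lBC wEq E we {d} {d'} compat ok rM rM'
    with d A ∧ (d B ∧ d C) in allKept
  ... | false =
    let (nab , nac , nbc) = atMostOneTrue ok allKept in
    h-step (iso (Iso-sameRestriction {N = N} {N'} {M} {M'} E compat (λ X → refl)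
      (trans (cong (filterᵇ d) we) (trans (sym (filter-move3 (T? ∘ d) x y z t nab nac nbc)) (cong (filterᵇ d) (sym wEq)))) rM rM'))
  ... | true =
    let (dA , dB , dC) = ∧-true⁻₃ {d A} allKept in
    project-move3-allKept {N} {N'} {M} {M'} A B C x y z t nAB nAC nBC lAB lBC wEq E we compat dA dB dC rM rM'

  project : {N N' M M' : Nanoword α} (s : Step τ N N') {d : Fin (n N) → Bool} {d' : Fin (n N') → Bool} →
            Compatible s d d' → RestrictionBy N M d → RestrictionBy N' M' d' → Homotopic τ M M'
  project {N} {N'} {M} {M'} (iso I@(_ , _ , _ , _ , w)) {d} compat rM rM' =
    h-step (iso (Iso-sameRestriction {N = N} {N'} {M} {M'} (Iso⇒Embedding {N = N} {N'} I) compat (λ X → refl) (cong (filterᵇ d) w) rM rM'))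
  project {N} {N'} {M} {M'} (move1 A x y wEq r) compat =
    project-move1 {N} {N'} {M} {M'} A x y wEq (isNot-restriction {N = N} {N'} r) compat
  project {N} {N'} {M} {M'} (move2 A B x y z wEq lAB r) (compat , dAB) =
    project-move2 {N} {N'} {M} {M'} A B x y z wEq lAB (isNot₂-restriction {N = N} {N'} r) compat dAB
  project {N} {N'} {M} {M'} (move3 A B C x y z t nAB nAC nBC lAB lBC wEq e inj onto lab we) (compat , ok) =
    project-move3 {N} {N'} {M} {M'} A B C x y z t nAB nAC nBC lAB lBC wEq
      (record { em = e ; em-inj = inj ; em-label = lab ; em-image = λ _ → refl ; em-onto = λ X _ → onto X }) we compat ok

Represents : {m : ℕ} → (Fin m → Bool) → (Fin m → Set) → Set
Represents d P = ∀ X → (d X ≡ true → P X) × (P X → d X ≡ true)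

represent-equivalent⇒≡ : ∀ {a b : Bool} {P Q : Set} → (a ≡ true → P) × (P → a ≡ true) → (b ≡ true → Q) × (Q → b ≡ true) →
                         (P → Q) → (Q → P) → a ≡ b
represent-equivalent⇒≡ {true} {true} s s' f g = refl
represent-equivalent⇒≡ {true} {false} s s' f g = sym (proj₂ s' (f (proj₁ s refl)))
represent-equivalent⇒≡ {false} {true} s s' f g = proj₂ s (g (proj₁ s' refl))
represent-equivalent⇒≡ {false} {false} s s' f g = refl

-- Excluded middle for each of the finitely many letters is available under a double negation.
¬¬-represented : (m : ℕ) (P : Fin m → Set) → ¬ ¬ (Σ (Vec Bool m) λ v → Represents (lookup v) P)
¬¬-represented zero P k = k (v[] , λ ())
¬¬-represented (suc m) P k = ¬¬-represented m (P ∘ fs) λ { (v , rep) → ¬¬-excluded-middle (λ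
  { (inj₁ p) → k (true v∷ v , λ { fz → (λ _ → p) , (λ _ → refl) ; (fs X) → rep X })
  ; (inj₂ np) → k (false v∷ v , λ { fz → (λ ()) , (λ p → ⊥-elim (np p)) ; (fs X) → rep X }) }) }
  where
  ¬¬-excluded-middle : ¬ ¬ (P fz ⊎ ¬ P fz)
  ¬¬-excluded-middle k₀ = k₀ (inj₂ λ p → k₀ (inj₁ p))

∃-Vec-Bool? : (m : ℕ) (Q : Vec Bool m → Set) → (∀ v → Dec (Q v)) → Dec (Σ (Vec Bool m) Q)
∃-Vec-Bool? zero Q Q? with Q? v[]
... | yes q = yes (v[] , q)
... | no nq = no λ { (v[] , q) → nq q }
∃-Vec-Bool? (suc m) Q Q? with ∃-Vec-Bool? m (λ v → Q (true v∷ v)) (λ v → Q? (true v∷ v))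
... | yes (v , q) = yes (true v∷ v , q)
... | no n₁ with ∃-Vec-Bool? m (λ v → Q (false v∷ v)) (λ v → Q? (false v∷ v))
...   | yes (v , q) = yes (false v∷ v , q)
...   | no n₂ = no λ { (true v∷ v , q) → n₁ (v , q) ; (false v∷ v , q) → n₂ (v , q) }

module ProjectionAlongHomotopy {α : Set} (τ : α → α) where
  open Projection τ

  Compatible? : {N N' : Nanoword α} (s : Step τ N N') (d : Fin (n N) → Bool) (d' : Fin (n N') → Bool) → Dec (Compatible s d d')
  Compatible? (iso (e , _)) d d' = all? (λ B → d' B ≟ᵇ d (e B))
  Compatible? (move1 A x y _ (e , _)) d d' = all? (λ B → d' B ≟ᵇ d (e B))
  Compatible? (move2 A B x y z _ _ (e , _)) d d' = all? (λ B → d' B ≟ᵇ d (e B)) ×-dec (d A ≟ᵇ d B)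
  Compatible? (move3 A B C x y z t _ _ _ _ _ _ e _ _ _ _) d d' =
    all? (λ B → d' B ≟ᵇ d (e B)) ×-dec (notExactlyTwo (d A) (d B) (d C) ≟ᵇ true)

  CompatibleChoice : {N N' : Nanoword α} → Homotopic τ N N' → (Fin (n N) → Bool) → (Fin (n N') → Bool) → Set
  CompatibleChoice h-refl d d' = ∀ X → d X ≡ d' X
  CompatibleChoice (h-step s) d d' = Compatible s d d'
  CompatibleChoice (h-sym h) d d' = CompatibleChoice h d' d
  CompatibleChoice (h-trans {N' = M} h₁ h₂) d d' =
    Σ (Vec Bool (n M)) λ v → CompatibleChoice h₁ d (lookup v) × CompatibleChoice h₂ (lookup v) d'

  CompatibleChoice? : {N N' : Nanoword α} (h : Homotopic τ N N') (d : Fin (n N) → Bool) (d' : Fin (n N') → Bool) →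
                      Dec (CompatibleChoice h d d')
  CompatibleChoice? h-refl d d' = all? (λ X → d X ≟ᵇ d' X)
  CompatibleChoice? (h-step s) d d' = Compatible? s d d'
  CompatibleChoice? (h-sym h) d d' = CompatibleChoice? h d' d
  CompatibleChoice? (h-trans {N' = M} h₁ h₂) d d' =
    ∃-Vec-Bool? (n M) _ (λ v → CompatibleChoice? h₁ d (lookup v) ×-dec CompatibleChoice? h₂ (lookup v) d')

  project* : {N N' M M' : Nanoword α} (h : Homotopic τ N N') {d : Fin (n N) → Bool} {d' : Fin (n N') → Bool} →
             CompatibleChoice h d d' → RestrictionBy N M d → RestrictionBy N' M' d' → Homotopic τ M M'
  project* {N} {_} {M} {M'} h-refl {d} {d'} same rM rM' =
    h-step (iso (Embedding-transfer {N = N} {M} {M'} EM EM' (word M)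
      (trans (Restriction-word {N = N} {M'} d' rM') (trans (sym (filterᵇ-cong same (word N))) (sym (Restriction-word {N = N} {M} d rM))))))
    where
    EM : Embedding N M d
    EM = Restriction⇒Embedding {N = N} {M} d rM
    EM' : Embedding N M' d
    EM' = Embedding-cong (λ X → sym (same X)) (Restriction⇒Embedding {N = N} {M'} d' rM')
  project* (h-step s) compat rM rM' = project s compat rM rM'
  project* (h-sym h) choice rM rM' = h-sym (project* h choice rM' rM)
  project* (h-trans {N' = K} h₁ h₂) (v , choice₁ , choice₂) rM rM' =
    h-trans {N' = restrict K (lookup v)} (project* h₁ choice₁ rM (restrict-restriction K (lookup v))) (project* h₂ choice₂ (restrict-restriction K (lookup v)) rM')

  module _ (P : (N : Nanoword α) → Fin (n N) → Set)
           (P-compatible : {N N' : Nanoword α} (s : Step τ N N') (d : Fin (n N) → Bool) (d' : Fin (n N') → Bool) →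
                           Represents d (P N) → Represents d' (P N') → Compatible s d d') where

    ¬¬-compatibleChoice : {N N' : Nanoword α} (h : Homotopic τ N N') (d : Fin (n N) → Bool) (d' : Fin (n N') → Bool) →
                          Represents d (P N) → Represents d' (P N') → ¬ ¬ CompatibleChoice h d d'
    ¬¬-compatibleChoice h-refl d d' rep rep' k = k (λ X → represent-equivalent⇒≡ (rep X) (rep' X) (λ p → p) (λ p → p))
    ¬¬-compatibleChoice (h-step s) d d' rep rep' k = k (P-compatible s d d' rep rep')
    ¬¬-compatibleChoice (h-sym h) d d' rep rep' = ¬¬-compatibleChoice h d' d rep' rep
    ¬¬-compatibleChoice (h-trans {N' = K} h₁ h₂) d d' rep rep' k =
      ¬¬-represented (n K) (P K) λ { (v , repK) →
        ¬¬-compatibleChoice h₁ d (lookup v) rep repK λ c₁ → ¬¬-compatibleChoice h₂ (lookup v) d' repK rep' λ c₂ → k (v , c₁ , c₂) }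

    -- The restriction itself decides P on every letter, since every letter occurs in the word.
    decision : (N M : Nanoword α) → Restriction N M (P N) → (X : Fin (n N)) → Dec (P N X)
    decision N M (_ , _ , _ , _ , filtered) X = All-lookup (Filtered-decisions filtered) (letter-occurs N X)

    decision-represents : (N M : Nanoword α) (r : Restriction N M (P N)) → Represents (λ X → does (decision N M r X)) (P N)
    decision-represents N M r X with decision N M r X
    ... | yes p = (λ _ → p) , (λ _ → refl)
    ... | no np = (λ ()) , (λ p → ⊥-elim (np p))

    restrictions-homotopic : {N N' M M' : Nanoword α} → Homotopic τ N N' → Restriction N M (P N) → Restriction N' M' (P N') →
                             Homotopic τ M M'
    restrictions-homotopic {N} {N'} {M} {M'} h r r' with CompatibleChoice? h d d'
      where d = λ X → does (decision N M r X)
            d' = λ X → does (decision N' M' r' X)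
    ... | yes choice = project* h choice (asRestrictionBy N M r) (asRestrictionBy N' M' r')
      where
      asRestrictionBy : (N M : Nanoword α) (r : Restriction N M (P N)) → RestrictionBy N M (λ X → does (decision N M r X))
      asRestrictionBy N M r = Restriction-cong {N = N} {M} (λ X p → proj₂ (decision-represents N M r X) p)
                                                   (λ X p → proj₁ (decision-represents N M r X) p) r
    ... | no ¬choice = ⊥-elim (¬¬-compatibleChoice h _ _ (decision-represents N M r) (decision-represents N' M' r') ¬choice)

-- Linking signs and brackets

oneOf? : {m : ℕ} (P Q : Fin m) → Decidable (λ C → (C ≡ P) ⊎ (C ≡ Q))
oneOf? P Q C = (C ≟ P) ⊎-dec (C ≟ Q)

patternAB-++ : {m : ℕ} (P Q : Fin m) (u v : List (Fin m)) → patternAB P Q (u ++ v) ≡ patternAB P Q u ++ patternAB P Q v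
patternAB-++ P Q = filter-++ (oneOf? P Q)

patternAB-keepˡ : {m : ℕ} (P Q : Fin m) (v : List (Fin m)) → patternAB P Q (P ∷ v) ≡ P ∷ patternAB P Q v
patternAB-keepˡ P Q v = filter-accept (oneOf? P Q) {x = P} {xs = v} (inj₁ refl)

patternAB-keepʳ : {m : ℕ} (P Q : Fin m) (v : List (Fin m)) → patternAB P Q (Q ∷ v) ≡ Q ∷ patternAB P Q v
patternAB-keepʳ P Q v = filter-accept (oneOf? P Q) {x = Q} {xs = v} (inj₂ refl)

patternAB-drop : {m : ℕ} (P Q Z : Fin m) (v : List (Fin m)) → Z ≢ P → Z ≢ Q → patternAB P Q (Z ∷ v) ≡ patternAB P Q v
patternAB-drop P Q Z v n₁ n₂ = filter-reject (oneOf? P Q) {x = Z} {xs = v} (λ { (inj₁ p) → n₁ p ; (inj₂ p) → n₂ p })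

patternAB-sym : {m : ℕ} (P Q : Fin m) (w : List (Fin m)) → patternAB P Q w ≡ patternAB Q P w
patternAB-sym P Q = filter-≐ (oneOf? P Q) (oneOf? Q P) (swap , swap)
  where swap : ∀ {A B : Set} → A ⊎ B → B ⊎ A
        swap (inj₁ p) = inj₂ p
        swap (inj₂ p) = inj₁ p

patternAB-∷-cong : {m : ℕ} (P Q Z : Fin m) {u v : List (Fin m)} → patternAB P Q u ≡ patternAB P Q v →
                   patternAB P Q (Z ∷ u) ≡ patternAB P Q (Z ∷ v)
patternAB-∷-cong P Q Z {u} {v} eq = by (oneOf? P Q Z)
  where
  by : Dec ((Z ≡ P) ⊎ (Z ≡ Q)) → patternAB P Q (Z ∷ u) ≡ patternAB P Q (Z ∷ v)
  by (yes p) = trans (filter-accept (oneOf? P Q) p) (trans (cong (Z ∷_) eq) (sym (filter-accept (oneOf? P Q) p)))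
  by (no p) = trans (filter-reject (oneOf? P Q) p) (trans eq (sym (filter-reject (oneOf? P Q) p)))

patternAB-map : {m k : ℕ} (e : Fin k → Fin m) → Injective _≡_ _≡_ e → (P Q : Fin k) (w : List (Fin k)) →
                map e (patternAB P Q w) ≡ patternAB (e P) (e Q) (map e w)
patternAB-map e inj P Q [] = refl
patternAB-map e inj P Q (Z ∷ w) = by (oneOf? P Q Z)
  where
  by : Dec ((Z ≡ P) ⊎ (Z ≡ Q)) → map e (patternAB P Q (Z ∷ w)) ≡ patternAB (e P) (e Q) (map e (Z ∷ w))
  by (yes (inj₁ p)) = trans (cong (map e) (filter-accept (oneOf? P Q) (inj₁ p))) (trans (cong (e Z ∷_) (patternAB-map e inj P Q w))
                        (sym (filter-accept (oneOf? (e P) (e Q)) {x = e Z} (inj₁ (cong e p)))))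
  by (yes (inj₂ p)) = trans (cong (map e) (filter-accept (oneOf? P Q) (inj₂ p))) (trans (cong (e Z ∷_) (patternAB-map e inj P Q w))
                        (sym (filter-accept (oneOf? (e P) (e Q)) {x = e Z} (inj₂ (cong e p)))))
  by (no np) = trans (cong (map e) (filter-reject (oneOf? P Q) np)) (trans (patternAB-map e inj P Q w)
                 (sym (filter-reject (oneOf? (e P) (e Q)) {x = e Z} (λ { (inj₁ q) → np (inj₁ (inj q)) ; (inj₂ q) → np (inj₂ (inj q)) }))))

patternAB-filterᵇ : {m : ℕ} (q : Fin m → Bool) (P Q : Fin m) → q P ≡ true → q Q ≡ true → (w : List (Fin m)) →
                    patternAB P Q (filterᵇ q w) ≡ patternAB P Q w
patternAB-filterᵇ q P Q qP qQ [] = refl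
patternAB-filterᵇ q P Q qP qQ (Z ∷ w) with q Z in qZ
... | true = patternAB-∷-cong P Q Z (patternAB-filterᵇ q P Q qP qQ w)
... | false = trans (patternAB-filterᵇ q P Q qP qQ w)
                (sym (patternAB-drop P Q Z w (λ { refl → false≢true (trans (sym qZ) qP) }) (λ { refl → false≢true (trans (sym qZ) qQ) })))

count≡0-tail : {m : ℕ} (P Z : Fin m) (v : List (Fin m)) → count P (Z ∷ v) ≡ 0 → count P v ≡ 0 × Z ≢ P
count≡0-tail P Z v eq with Z ≟ P
count≡0-tail P Z v () | yes refl
... | no ne = eq , ne

patternAB-withoutˡ : {m : ℕ} (P Q : Fin m) (u : List (Fin m)) → count P u ≡ 0 → patternAB P Q u ≡ filter (_≟ Q) u
patternAB-withoutˡ P Q [] c = refl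
patternAB-withoutˡ P Q (Z ∷ v) c with count≡0-tail P Z v c
... | c' , zp with Q ≟ Z
...   | yes refl = trans (patternAB-keepʳ P Z v)
                     (trans (cong (Z ∷_) (patternAB-withoutˡ P Z v c')) (sym (filter-accept (_≟ Z) {x = Z} {xs = v} refl)))
...   | no zq = trans (patternAB-drop P Q Z v zp (λ q → zq (sym q)))
                  (trans (patternAB-withoutˡ P Q v c') (sym (filter-reject (_≟ Q) {x = Z} {xs = v} (λ q → zq (sym q)))))

count≡0⇒filter≡[] : {m : ℕ} (Q : Fin m) (u : List (Fin m)) → count Q u ≡ 0 → filter (_≟ Q) u ≡ []
count≡0⇒filter≡[] Q u c with filter (_≟ Q) u
... | [] = refl

patternAB-absent : {m : ℕ} (P Q : Fin m) (u : List (Fin m)) → count P u ≡ 0 → count Q u ≡ 0 → patternAB P Q u ≡ []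
patternAB-absent P Q u c₁ c₂ = trans (patternAB-withoutˡ P Q u c₁) (count≡0⇒filter≡[] Q u c₂)

filter-≟-replicate : {m : ℕ} (Q : Fin m) (u : List (Fin m)) → filter (_≟ Q) u ≡ replicate (count Q u) Q
filter-≟-replicate Q [] = refl
filter-≟-replicate Q (Z ∷ v) with Z ≟ Q
... | yes refl = cong (Z ∷_) (filter-≟-replicate Q v)
... | no _ = filter-≟-replicate Q v

signed : {α A B : Set} → Dec A → Dec B → α → List (α × Bool)
signed (yes _) _ a = (a , true) ∷ []
signed (no _) (yes _) a = (a , false) ∷ []
signed (no _) (no _) a = []

signed-cong : {α A B A' B' : Set} (a : Dec A) (b : Dec B) (a' : Dec A') (b' : Dec B') (g : α) →
              (A → A') → (A' → A) → (¬ A → B → B') → (¬ A' → B' → B) → signed a b g ≡ signed a' b' g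
signed-cong (yes p) b (yes p') b' g f f' h h' = refl
signed-cong (yes p) b (no p') b' g f f' h h' = ⊥-elim (p' (f p))
signed-cong (no p) b (yes p') b' g f f' h h' = ⊥-elim (p (f' p'))
signed-cong (no p) (yes q) (no p') (yes q') g f f' h h' = refl
signed-cong (no p) (yes q) (no p') (no q') g f f' h h' = ⊥-elim (q' (h p q))
signed-cong (no p) (no q) (no p') (yes q') g f f' h h' = ⊥-elim (q (h' p' q'))
signed-cong (no p) (no q) (no p') (no q') g f f' h h' = refl

contribution : {m : ℕ} {α : Set} → List (Fin m) → Fin m → Fin m → α → List (α × Bool)
contribution l D E a = signed (≡-dec _≟_ l (D ∷ E ∷ D ∷ E ∷ [])) (≡-dec _≟_ l (E ∷ D ∷ E ∷ D ∷ [])) a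

contrib≡contribution : {α : Set} (N : Nanoword α) (D E : Fin (n N)) →
                       contrib N D E ≡ contribution (patternAB D E (word N)) D E (label N E)
contrib≡contribution N D E with ≡-dec _≟_ (patternAB D E (word N)) (D ∷ E ∷ D ∷ E ∷ [])
... | yes p = refl
... | no p with ≡-dec _≟_ (patternAB D E (word N)) (E ∷ D ∷ E ∷ D ∷ [])
...   | yes q = refl
...   | no q = refl

contribution-map : {m k : ℕ} {α : Set} (e : Fin k → Fin m) → Injective _≡_ _≡_ e → (l : List (Fin k)) (D E : Fin k) (a : α) →
                   contribution (map e l) (e D) (e E) a ≡ contribution l D E a
contribution-map e inj l D E a =
  signed-cong _ _ _ _ a (map-injective inj) (cong (map e)) (λ _ → map-injective inj) (λ _ → cong (map e))

contribution-DEDE : {m : ℕ} {α : Set} (D E : Fin m) (a : α) → contribution (D ∷ E ∷ D ∷ E ∷ []) D E a ≡ (a , true) ∷ []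
contribution-DEDE D E a with ≡-dec _≟_ (D ∷ E ∷ D ∷ E ∷ []) (D ∷ E ∷ D ∷ E ∷ [])
... | yes _ = refl
... | no p = ⊥-elim (p refl)

contribution-EDED : {m : ℕ} {α : Set} (D E : Fin m) (a : α) → D ≢ E → contribution (E ∷ D ∷ E ∷ D ∷ []) D E a ≡ (a , false) ∷ []
contribution-EDED D E a ne with ≡-dec _≟_ (E ∷ D ∷ E ∷ D ∷ []) (D ∷ E ∷ D ∷ E ∷ [])
... | yes p = ⊥-elim (ne (sym (∷-injectiveˡ p)))
... | no p with ≡-dec _≟_ (E ∷ D ∷ E ∷ D ∷ []) (E ∷ D ∷ E ∷ D ∷ [])
...   | yes _ = refl
...   | no q = ⊥-elim (q refl)

contribution-unlinked : {m : ℕ} {α : Set} (l : List (Fin m)) (D E : Fin m) (a : α) →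
                        l ≢ D ∷ E ∷ D ∷ E ∷ [] → l ≢ E ∷ D ∷ E ∷ D ∷ [] → contribution l D E a ≡ []
contribution-unlinked l D E a n₁ n₂ with ≡-dec _≟_ l (D ∷ E ∷ D ∷ E ∷ [])
... | yes p = ⊥-elim (n₁ p)
... | no p with ≡-dec _≟_ l (E ∷ D ∷ E ∷ D ∷ [])
...   | yes q = ⊥-elim (n₂ q)
...   | no q = refl

contribution-DDEE : {m : ℕ} {α : Set} (D E : Fin m) (a : α) → D ≢ E → contribution (D ∷ D ∷ E ∷ E ∷ []) D E a ≡ []
contribution-DDEE D E a ne = contribution-unlinked _ D E a (λ p → ne (∷-injectiveˡ (∷-injectiveʳ p))) (λ p → ne (∷-injectiveˡ p))

contribution-EEDD : {m : ℕ} {α : Set} (D E : Fin m) (a : α) → D ≢ E → contribution (E ∷ E ∷ D ∷ D ∷ []) D E a ≡ []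
contribution-EEDD D E a ne =
  contribution-unlinked _ D E a (λ p → ne (sym (∷-injectiveˡ p))) (λ p → ne (sym (∷-injectiveˡ (∷-injectiveʳ p))))

contribution-DEED : {m : ℕ} {α : Set} (D E : Fin m) (a : α) → D ≢ E → contribution (D ∷ E ∷ E ∷ D ∷ []) D E a ≡ []
contribution-DEED D E a ne =
  contribution-unlinked _ D E a (λ p → ne (sym (∷-injectiveˡ (∷-injectiveʳ (∷-injectiveʳ p))))) (λ p → ne (∷-injectiveˡ p))

contribution-EDDE : {m : ℕ} {α : Set} (D E : Fin m) (a : α) → D ≢ E → contribution (E ∷ D ∷ D ∷ E ∷ []) D E a ≡ []
contribution-EDDE D E a ne =
  contribution-unlinked _ D E a (λ p → ne (sym (∷-injectiveˡ p))) (λ p → ne (∷-injectiveˡ (∷-injectiveʳ (∷-injectiveʳ p))))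

contribution-DD : {m : ℕ} {α : Set} (D : Fin m) (a : α) → contribution (D ∷ D ∷ []) D D a ≡ []
contribution-DD D a = contribution-unlinked _ D D a (λ ()) (λ ())

-- The subword of the occurrences of X and Y when Y occurs exactly at two given places.
shape : {m : ℕ} → Fin m → Fin m → ℕ → ℕ → ℕ → List (Fin m)
shape X Y i j k = replicate i X ++ Y ∷ replicate j X ++ Y ∷ replicate k X

shape≡XYXY : {m : ℕ} (X Y : Fin m) → Y ≢ X → (i j k : ℕ) → shape X Y i j k ≡ X ∷ Y ∷ X ∷ Y ∷ [] → (i , j , k) ≡ (1 , 1 , 0)
shape≡XYXY X Y ne zero j k p = ⊥-elim (ne (∷-injectiveˡ p))
shape≡XYXY X Y ne (suc zero) zero k p = ⊥-elim (ne (∷-injectiveˡ (∷-injectiveʳ (∷-injectiveʳ p))))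
shape≡XYXY X Y ne (suc zero) (suc zero) zero p = refl
shape≡XYXY X Y ne (suc zero) (suc zero) (suc k) p with ∷-injectiveʳ (∷-injectiveʳ (∷-injectiveʳ (∷-injectiveʳ p)))
... | ()
shape≡XYXY X Y ne (suc zero) (suc (suc j)) k p = ⊥-elim (ne (sym (∷-injectiveˡ (∷-injectiveʳ (∷-injectiveʳ (∷-injectiveʳ p))))))
shape≡XYXY X Y ne (suc (suc i)) j k p = ⊥-elim (ne (sym (∷-injectiveˡ (∷-injectiveʳ p))))

shape≡YXYX : {m : ℕ} (X Y : Fin m) → Y ≢ X → (i j k : ℕ) → shape X Y i j k ≡ Y ∷ X ∷ Y ∷ X ∷ [] → (i , j , k) ≡ (0 , 1 , 1)
shape≡YXYX X Y ne zero zero k p = ⊥-elim (ne (∷-injectiveˡ (∷-injectiveʳ p)))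
shape≡YXYX X Y ne zero (suc zero) zero p with ∷-injectiveʳ (∷-injectiveʳ (∷-injectiveʳ p))
... | ()
shape≡YXYX X Y ne zero (suc zero) (suc zero) p = refl
shape≡YXYX X Y ne zero (suc zero) (suc (suc k)) p with ∷-injectiveʳ (∷-injectiveʳ (∷-injectiveʳ (∷-injectiveʳ p)))
... | ()
shape≡YXYX X Y ne zero (suc (suc j)) k p = ⊥-elim (ne (sym (∷-injectiveˡ (∷-injectiveʳ (∷-injectiveʳ p)))))
shape≡YXYX X Y ne (suc i) j k p = ⊥-elim (ne (sym (∷-injectiveˡ p)))

_≟₃_ : (t u : ℕ × ℕ × ℕ) → Dec (t ≡ u)
_≟₃_ = ×-≡-dec _≟ℕ_ (×-≡-dec _≟ℕ_ _≟ℕ_)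

shapeSignˡ shapeSignʳ : {α : Set} → ℕ → ℕ → ℕ → α → List (α × Bool)
shapeSignˡ i j k a = signed ((i , j , k) ≟₃ (1 , 1 , 0)) ((i , j , k) ≟₃ (0 , 1 , 1)) a
shapeSignʳ i j k a = signed ((i , j , k) ≟₃ (0 , 1 , 1)) ((i , j , k) ≟₃ (1 , 1 , 0)) a

contribution-shapeˡ : {m : ℕ} {α : Set} (X Y : Fin m) → Y ≢ X → (i j k : ℕ) (a : α) →
                      contribution (shape X Y i j k) X Y a ≡ shapeSignˡ i j k a
contribution-shapeˡ X Y ne i j k a =
  signed-cong _ _ _ _ a (shape≡XYXY X Y ne i j k) (λ { refl → refl }) (λ _ → shape≡YXYX X Y ne i j k) (λ { _ refl → refl })

contribution-shapeʳ : {m : ℕ} {α : Set} (X Y : Fin m) → Y ≢ X → (i j k : ℕ) (a : α) →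
                      contribution (shape X Y i j k) Y X a ≡ shapeSignʳ i j k a
contribution-shapeʳ X Y ne i j k a =
  signed-cong _ _ _ _ a (shape≡YXYX X Y ne i j k) (λ { refl → refl }) (λ _ → shape≡XYXY X Y ne i j k) (λ { _ refl → refl })

indicator : {m : ℕ} → Fin m → Fin m → ℕ
indicator X Z = if does (Z ≟ X) then 1 else 0

indicator-self : {m : ℕ} (X : Fin m) → indicator X X ≡ 1
indicator-self X with X ≟ X
... | yes _ = refl
... | no p = ⊥-elim (p refl)

indicator-other : {m : ℕ} (X Z : Fin m) → Z ≢ X → indicator X Z ≡ 0
indicator-other X Z ne with Z ≟ X
... | yes p = ⊥-elim (ne p)
... | no _ = refl

count-∷ : {m : ℕ} (X Z : Fin m) (v : List (Fin m)) → count X (Z ∷ v) ≡ indicator X Z + count X v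
count-∷ X Z v with Z ≟ X
... | yes _ = refl
... | no _ = refl

count-move2 : {m : ℕ} (X A B : Fin m) (x y z : List (Fin m)) →
              count X (x ++ A ∷ B ∷ y ++ B ∷ A ∷ z) ≡
              count X x + (indicator X A + (indicator X B + (count X y + (indicator X B + (indicator X A + count X z)))))
count-move2 X A B x y z
  rewrite count-++ X x (A ∷ B ∷ y ++ B ∷ A ∷ z) | count-∷ X A (B ∷ y ++ B ∷ A ∷ z) | count-∷ X B (y ++ B ∷ A ∷ z)
        | count-++ X y (B ∷ A ∷ z) | count-∷ X B (A ∷ z) | count-∷ X A z = refl

count-move3-before : {m : ℕ} (X A B C : Fin m) (x y z t : List (Fin m)) →
                     count X (move3-before x y z t A B C) ≡
                     count X x + (indicator X A + (indicator X B + (count X y + (indicator X A + (indicator X C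
                       + (count X z + (indicator X B + (indicator X C + count X t))))))))
count-move3-before X A B C x y z t
  rewrite count-++ X x (A ∷ B ∷ y ++ A ∷ C ∷ z ++ B ∷ C ∷ t) | count-∷ X A (B ∷ y ++ A ∷ C ∷ z ++ B ∷ C ∷ t)
        | count-∷ X B (y ++ A ∷ C ∷ z ++ B ∷ C ∷ t) | count-++ X y (A ∷ C ∷ z ++ B ∷ C ∷ t) | count-∷ X A (C ∷ z ++ B ∷ C ∷ t)
        | count-∷ X C (z ++ B ∷ C ∷ t) | count-++ X z (B ∷ C ∷ t) | count-∷ X B (C ∷ t) | count-∷ X C t = refl

+₃≡0 : (a b c : ℕ) → a + (b + c) ≡ 0 → a ≡ 0 × b ≡ 0 × c ≡ 0
+₃≡0 zero zero zero p = refl , refl , refl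

+₄≡0 : (a b c d : ℕ) → a + (b + (c + d)) ≡ 0 → a ≡ 0 × b ≡ 0 × c ≡ 0 × d ≡ 0
+₄≡0 zero zero zero zero p = refl , refl , refl , refl

suc-suc-injective : ∀ {u v : ℕ} → suc (suc u) ≡ suc (suc v) → u ≡ v
suc-suc-injective refl = refl

twoOccurrences⇒absent : (a b c : ℕ) → a + suc (b + suc c) ≡ 2 → a ≡ 0 × b ≡ 0 × c ≡ 0
twoOccurrences⇒absent a b c p = +₃≡0 a b c (suc-suc-injective (trans (sym (normalise a b c)) p))
  where normalise : ∀ a b c → a + suc (b + suc c) ≡ suc (suc (a + (b + c)))
        normalise = solve-∀

move2-absentA : {m : ℕ} (A B : Fin m) (x y z : List (Fin m)) → B ≢ A → count A (x ++ A ∷ B ∷ y ++ B ∷ A ∷ z) ≡ 2 →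
                count A x ≡ 0 × count A y ≡ 0 × count A z ≡ 0
move2-absentA A B x y z ne c =
  twoOccurrences⇒absent (count A x) (count A y) (count A z) (trans (sym indicators) (trans (sym (count-move2 A A B x y z)) c))
  where
  indicators : count A x + (indicator A A + (indicator A B + (count A y + (indicator A B + (indicator A A + count A z)))))
               ≡ count A x + suc (count A y + suc (count A z))
  indicators rewrite indicator-self A | indicator-other A B ne = refl

move2-absentB : {m : ℕ} (A B : Fin m) (x y z : List (Fin m)) → A ≢ B → count B (x ++ A ∷ B ∷ y ++ B ∷ A ∷ z) ≡ 2 →
                count B x ≡ 0 × count B y ≡ 0 × count B z ≡ 0
move2-absentB A B x y z ne c =
  twoOccurrences⇒absent (count B x) (count B y) (count B z) (trans (sym indicators) (trans (sym (count-move2 B A B x y z)) c))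
  where
  indicators : count B x + (indicator B A + (indicator B B + (count B y + (indicator B B + (indicator B A + count B z)))))
               ≡ count B x + suc (count B y + suc (count B z))
  indicators rewrite indicator-self B | indicator-other B A ne = refl

move2-distinct : {m : ℕ} (A B : Fin m) (x y z : List (Fin m)) → count A (x ++ A ∷ B ∷ y ++ B ∷ A ∷ z) ≡ 2 → A ≢ B
move2-distinct A .A x y z c refl with trans (sym (normalise (count A x) (count A y) (count A z))) (trans (sym indicators) (trans (sym (count-move2 A A A x y z)) c))
  where
  normalise : ∀ a b c → a + suc (suc (b + suc (suc c))) ≡ suc (suc (suc (suc (a + (b + c)))))
  normalise = solve-∀
  indicators : count A x + (indicator A A + (indicator A A + (count A y + (indicator A A + (indicator A A + count A z)))))
               ≡ count A x + suc (suc (count A y + suc (suc (count A z))))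
  indicators rewrite indicator-self A = refl
... | ()

AA≢XAXA : {m : ℕ} (X A : Fin m) → X ≢ A → (p r : List (Fin m)) → p ++ A ∷ A ∷ r ≢ X ∷ A ∷ X ∷ A ∷ []
AA≢XAXA X A ne [] r q = ne (sym (∷-injectiveˡ q))
AA≢XAXA X A ne (_ ∷ []) r q = ne (sym (∷-injectiveˡ (∷-injectiveʳ (∷-injectiveʳ q))))
AA≢XAXA X A ne (_ ∷ _ ∷ []) r q = ne (sym (∷-injectiveˡ (∷-injectiveʳ (∷-injectiveʳ q))))
AA≢XAXA X A ne (_ ∷ _ ∷ _ ∷ []) r ()
AA≢XAXA X A ne (_ ∷ _ ∷ _ ∷ _ ∷ p) r q with ++-conicalʳ p _ (∷-injectiveʳ (∷-injectiveʳ (∷-injectiveʳ (∷-injectiveʳ q))))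
... | ()

AA≢AXAX : {m : ℕ} (X A : Fin m) → X ≢ A → (p r : List (Fin m)) → p ++ A ∷ A ∷ r ≢ A ∷ X ∷ A ∷ X ∷ []
AA≢AXAX X A ne [] r q = ne (sym (∷-injectiveˡ (∷-injectiveʳ q)))
AA≢AXAX X A ne (_ ∷ []) r q = ne (sym (∷-injectiveˡ (∷-injectiveʳ q)))
AA≢AXAX X A ne (_ ∷ _ ∷ []) r q = ne (sym (∷-injectiveˡ (∷-injectiveʳ (∷-injectiveʳ (∷-injectiveʳ q)))))
AA≢AXAX X A ne (_ ∷ _ ∷ _ ∷ []) r ()
AA≢AXAX X A ne (_ ∷ _ ∷ _ ∷ _ ∷ p) r q with ++-conicalʳ p _ (∷-injectiveʳ (∷-injectiveʳ (∷-injectiveʳ (∷-injectiveʳ q))))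
... | ()

move1-contrib≡[] : {α : Set} (N : Nanoword α) (A : Fin (n N)) (x y : List (Fin (n N))) → word N ≡ x ++ A ∷ A ∷ y →
                   (X : Fin (n N)) → X ≢ A → contrib N X A ≡ []
move1-contrib≡[] N A x y wEq X ne = trans (contrib≡contribution N X A)
  (contribution-unlinked _ X A (label N A) (λ q → AA≢XAXA X A ne _ _ (trans (sym subword) q))
                                           (λ q → AA≢AXAX X A ne _ _ (trans (sym subword) q)))
  where
  subword : patternAB X A (word N) ≡ patternAB X A x ++ A ∷ A ∷ patternAB X A y
  subword = trans (cong (patternAB X A) wEq) (trans (patternAB-++ X A x (A ∷ A ∷ y))
              (cong (patternAB X A x ++_) (trans (patternAB-keepʳ X A (A ∷ y)) (cong (A ∷_) (patternAB-keepʳ X A y)))))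

patternAB-replicateˡ : {m : ℕ} (X P : Fin m) (u : List (Fin m)) → count P u ≡ 0 → patternAB X P u ≡ replicate (count X u) X
patternAB-replicateˡ X P u c = trans (patternAB-sym X P u) (trans (patternAB-withoutˡ P X u c) (filter-≟-replicate X u))

patternAB-replicateʳ : {m : ℕ} (P X : Fin m) (u : List (Fin m)) → count P u ≡ 0 → patternAB P X u ≡ replicate (count X u) X
patternAB-replicateʳ P X u c = trans (patternAB-withoutˡ P X u c) (filter-≟-replicate X u)

patternAB-[P] : {m : ℕ} (P Q : Fin m) → patternAB P Q [ P ] ≡ [ P ]
patternAB-[P] P Q = patternAB-keepˡ P Q []

patternAB-[Q] : {m : ℕ} (P Q : Fin m) → patternAB P Q [ Q ] ≡ [ Q ]
patternAB-[Q] P Q = patternAB-keepʳ P Q []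

patternAB-[Z] : {m : ℕ} (P Q Z : Fin m) → Z ≢ P → Z ≢ Q → patternAB P Q [ Z ] ≡ []
patternAB-[Z] P Q Z n₁ n₂ = patternAB-drop P Q Z [] n₁ n₂

patternAB-move2 : {m : ℕ} (P Q A B : Fin m) (x y z : List (Fin m)) →
                  patternAB P Q (x ++ A ∷ B ∷ y ++ B ∷ A ∷ z) ≡
                  patternAB P Q x ++ patternAB P Q [ A ] ++ patternAB P Q [ B ] ++ patternAB P Q y ++
                  patternAB P Q [ B ] ++ patternAB P Q [ A ] ++ patternAB P Q z
patternAB-move2 P Q A B x y z
  rewrite patternAB-++ P Q x (A ∷ B ∷ y ++ B ∷ A ∷ z) | patternAB-++ P Q [ A ] (B ∷ y ++ B ∷ A ∷ z)
        | patternAB-++ P Q [ B ] (y ++ B ∷ A ∷ z) | patternAB-++ P Q y (B ∷ A ∷ z) | patternAB-++ P Q [ B ] (A ∷ z)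
        | patternAB-++ P Q [ A ] z = refl

allFin-counts : {m k : ℕ} (e : Fin k → Fin m) → Injective _≡_ _≡_ e → (ex : List (Fin m)) →
                (∀ x → (Σ (Fin k) (λ b → e b ≡ x) × count x ex ≡ 0) ⊎ ((∀ b → e b ≢ x) × count x ex ≡ 1)) →
                ∀ x → count x (allFin m) ≡ count x (map e (allFin k) ++ ex)
allFin-counts {m} {k} e inj ex h x with h x
... | inj₁ ((b , refl) , c₀) = trans (count-allFin m (e b)) (sym (trans (count-++ (e b) (map e (allFin k)) ex)
        (cong₂ _+_ (trans (count-map-injective inj b (allFin k)) (count-allFin k b)) c₀)))
... | inj₂ (nb , c₁) = trans (count-allFin m x) (sym (trans (count-++ x (map e (allFin k)) ex)
        (cong₂ _+_ (count-map-outside e x nb (allFin k)) c₁)))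

contrib-restriction : {α : Set} (N N' : Nanoword α) (e : Fin (n N') → Fin (n N)) → Injective _≡_ _≡_ e →
                      (∀ B → label N (e B) ≡ label N' B) → (q : Fin (n N) → Bool) → (∀ B → q (e B) ≡ true) →
                      map e (word N') ≡ filterᵇ q (word N) → ∀ D E → contrib N' D E ≡ contrib N (e D) (e E)
contrib-restriction N N' e inj lab q qe we D E = begin
  contrib N' D E                                                          ≡⟨ contrib≡contribution N' D E ⟩
  contribution (patternAB D E (word N')) D E (label N' E)                 ≡⟨ sym (contribution-map e inj _ D E _) ⟩
  contribution (map e (patternAB D E (word N'))) (e D) (e E) (label N' E) ≡⟨ cong (λ l → contribution l (e D) (e E) (label N' E)) subword ⟩
  contribution (patternAB (e D) (e E) (word N)) (e D) (e E) (label N' E) ≡⟨ cong (contribution _ (e D) (e E)) (sym (lab E)) ⟩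
  contribution (patternAB (e D) (e E) (word N)) (e D) (e E) (label N (e E)) ≡⟨ sym (contrib≡contribution N (e D) (e E)) ⟩
  contrib N (e D) (e E)                                                   ∎
  where
  open ≡-Reasoning
  subword : map e (patternAB D E (word N')) ≡ patternAB (e D) (e E) (word N)
  subword = trans (patternAB-map e inj D E (word N'))
              (trans (cong (patternAB (e D) (e E)) we) (patternAB-filterᵇ q (e D) (e E) (qe D) (qe E) (word N)))

-- Invariance of brackets under the moves

module Move2Subwords {α : Set} (N : Nanoword α) (A B : Fin (n N)) (x y z : List (Fin (n N)))
                     (wEq : word N ≡ x ++ A ∷ B ∷ y ++ B ∷ A ∷ z) where

  private
    w = x ++ A ∷ B ∷ y ++ B ∷ A ∷ z

    countA : count A w ≡ 2
    countA = trans (cong (count A) (sym wEq)) (twice N A)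

    countB : count B w ≡ 2
    countB = trans (cong (count B) (sym wEq)) (twice N B)

  A≢B : A ≢ B
  A≢B = move2-distinct A B x y z countA

  private
    absentA = move2-absentA A B x y z (λ p → A≢B (sym p)) countA
    absentB = move2-absentB A B x y z A≢B countB

    subwordXA : (X : Fin (n N)) → X ≢ A → X ≢ B → patternAB X A w ≡ shape X A (count X x) (count X y) (count X z)
    subwordXA X nA nB
      rewrite patternAB-move2 X A A B x y z | patternAB-[Q] X A | patternAB-[Z] X A B (λ p → nB (sym p)) (λ p → A≢B (sym p))
            | patternAB-replicateˡ X A x (proj₁ absentA) | patternAB-replicateˡ X A y (proj₁ (proj₂ absentA))
            | patternAB-replicateˡ X A z (proj₂ (proj₂ absentA)) = refl

    subwordXB : (X : Fin (n N)) → X ≢ A → X ≢ B → patternAB X B w ≡ shape X B (count X x) (count X y) (count X z)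
    subwordXB X nA nB
      rewrite patternAB-move2 X B A B x y z | patternAB-[Q] X B | patternAB-[Z] X B A (λ p → nA (sym p)) A≢B
            | patternAB-replicateˡ X B x (proj₁ absentB) | patternAB-replicateˡ X B y (proj₁ (proj₂ absentB))
            | patternAB-replicateˡ X B z (proj₂ (proj₂ absentB)) = refl

    subwordAA : patternAB A A w ≡ A ∷ A ∷ []
    subwordAA
      rewrite patternAB-move2 A A A B x y z | patternAB-[P] A A | patternAB-[Z] A A B (λ p → A≢B (sym p)) (λ p → A≢B (sym p))
            | patternAB-absent A A x (proj₁ absentA) (proj₁ absentA) | patternAB-absent A A y (proj₁ (proj₂ absentA)) (proj₁ (proj₂ absentA))
            | patternAB-absent A A z (proj₂ (proj₂ absentA)) (proj₂ (proj₂ absentA)) = refl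

    subwordBB : patternAB B B w ≡ B ∷ B ∷ []
    subwordBB
      rewrite patternAB-move2 B B A B x y z | patternAB-[P] B B | patternAB-[Z] B B A A≢B A≢B
            | patternAB-absent B B x (proj₁ absentB) (proj₁ absentB) | patternAB-absent B B y (proj₁ (proj₂ absentB)) (proj₁ (proj₂ absentB))
            | patternAB-absent B B z (proj₂ (proj₂ absentB)) (proj₂ (proj₂ absentB)) = refl

    subwordAB : patternAB A B w ≡ A ∷ B ∷ B ∷ A ∷ []
    subwordAB
      rewrite patternAB-move2 A B A B x y z | patternAB-[P] A B | patternAB-[Q] A B
            | patternAB-absent A B x (proj₁ absentA) (proj₁ absentB) | patternAB-absent A B y (proj₁ (proj₂ absentA)) (proj₁ (proj₂ absentB))
            | patternAB-absent A B z (proj₂ (proj₂ absentA)) (proj₂ (proj₂ absentB)) = refl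

    contrib-w : (P Q : Fin (n N)) → contrib N P Q ≡ contribution (patternAB P Q w) P Q (label N Q)
    contrib-w P Q = trans (contrib≡contribution N P Q) (cong (λ l → contribution (patternAB P Q l) P Q (label N Q)) wEq)

  contrib-A : (X : Fin (n N)) → X ≢ A → X ≢ B → contrib N X A ≡ shapeSignˡ (count X x) (count X y) (count X z) (label N A)
  contrib-A X nA nB = trans (contrib-w X A)
    (trans (cong (λ l → contribution l X A (label N A)) (subwordXA X nA nB)) (contribution-shapeˡ X A (λ p → nA (sym p)) _ _ _ _))

  contrib-B : (X : Fin (n N)) → X ≢ A → X ≢ B → contrib N X B ≡ shapeSignˡ (count X x) (count X y) (count X z) (label N B)
  contrib-B X nA nB = trans (contrib-w X B)
    (trans (cong (λ l → contribution l X B (label N B)) (subwordXB X nA nB)) (contribution-shapeˡ X B (λ p → nB (sym p)) _ _ _ _))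

  contrib-A≡contrib-B : ∀ E → contrib N A E ≡ contrib N B E
  contrib-A≡contrib-B E with E ≟ A | E ≟ B
  ... | yes refl | _ = begin
    contrib N A A                                    ≡⟨ contrib-w A A ⟩
    contribution (patternAB A A w) A A (label N A)   ≡⟨ cong (λ l → contribution l A A (label N A)) subwordAA ⟩
    contribution (A ∷ A ∷ []) A A (label N A)        ≡⟨ contribution-DD A _ ⟩
    []                                               ≡⟨ sym (contribution-EDDE B A _ (λ p → A≢B (sym p))) ⟩
    contribution (A ∷ B ∷ B ∷ A ∷ []) B A (label N A) ≡⟨ cong (λ l → contribution l B A (label N A)) (sym (trans (patternAB-sym B A w) subwordAB)) ⟩
    contribution (patternAB B A w) B A (label N A)   ≡⟨ sym (contrib-w B A) ⟩
    contrib N B A                                    ∎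
    where open ≡-Reasoning
  ... | no _ | yes refl = begin
    contrib N A B                                    ≡⟨ contrib-w A B ⟩
    contribution (patternAB A B w) A B (label N B)   ≡⟨ cong (λ l → contribution l A B (label N B)) subwordAB ⟩
    contribution (A ∷ B ∷ B ∷ A ∷ []) A B (label N B) ≡⟨ contribution-DEED A B _ A≢B ⟩
    []                                               ≡⟨ sym (contribution-DD B _) ⟩
    contribution (B ∷ B ∷ []) B B (label N B)        ≡⟨ cong (λ l → contribution l B B (label N B)) (sym subwordBB) ⟩
    contribution (patternAB B B w) B B (label N B)   ≡⟨ sym (contrib-w B B) ⟩
    contrib N B B                                    ∎
    where open ≡-Reasoning
  ... | no nA | no nB = begin
    contrib N A E                                    ≡⟨ contrib-w A E ⟩
    contribution (patternAB A E w) A E (label N E)   ≡⟨ cong (λ l → contribution l A E (label N E)) (trans (patternAB-sym A E w) (subwordXA E nA nB)) ⟩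
    contribution (shape E A i j k) A E (label N E)   ≡⟨ contribution-shapeʳ E A (λ p → nA (sym p)) _ _ _ _ ⟩
    shapeSignʳ i j k (label N E)                     ≡⟨ sym (contribution-shapeʳ E B (λ p → nB (sym p)) _ _ _ _) ⟩
    contribution (shape E B i j k) B E (label N E)   ≡⟨ cong (λ l → contribution l B E (label N E)) (sym (trans (patternAB-sym B E w) (subwordXB E nA nB))) ⟩
    contribution (patternAB B E w) B E (label N E)   ≡⟨ sym (contrib-w B E) ⟩
    contrib N B E                                    ∎
    where open ≡-Reasoning
          i = count E x ; j = count E y ; k = count E z

module BracketRestriction {α : Set} (τ : α → α) where
  open PiGroup τ
  open Products τ

  bracket-reindex : (N N' : Nanoword α) (e : Fin (n N') → Fin (n N)) (ex : List (Fin (n N))) →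
                    (∀ x → count x (allFin (n N)) ≡ count x (map e (allFin (n N')) ++ ex)) → (D' : Fin (n N')) →
                    (∀ E' → contrib N' D' E' ≡ contrib N (e D') (e E')) → concatMap (contrib N (e D')) ex ≈ [] →
                    bracket N' D' ≈ bracket N (e D')
  bracket-reindex N N' e ex counts D' contrib-e deleted≈[] = π-sym (
    concatMap-sameCount f (allFin (n N)) (map e (allFin (n N')) ++ ex) counts
    ⨾ ≡⇒≈ (concatMap-++ f (map e (allFin (n N'))) ex)
    ⨾ ++-trivialʳ (concatMap f (map e (allFin (n N')))) deleted≈[]
    ⨾ ≡⇒≈ (concatMap-map f e (allFin (n N')))
    ⨾ concatMap-cong-≈ (λ E' → f (e E')) (contrib N' D') (allFin (n N')) (λ E' → ≡⇒≈ (sym (contrib-e E'))))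
    where f = contrib N (e D')

  move2-contribs-cancel : (N : Nanoword α) (A B : Fin (n N)) (x y z : List (Fin (n N))) →
                          (wEq : word N ≡ x ++ A ∷ B ∷ y ++ B ∷ A ∷ z) → label N B ≡ τ (label N A) →
                          (X : Fin (n N)) → X ≢ A → X ≢ B → contrib N X A ++ contrib N X B ≈ []
  move2-contribs-cancel N A B x y z wEq lAB X nA nB =
    ≡⇒≈ (cong₂ _++_ (contrib-A X nA nB) (trans (contrib-B X nA nB) (cong (shapeSignˡ i j k) lAB))) ⨾ τ-cancels
    where
    open Move2Subwords N A B x y z wEq
    i = count X x ; j = count X y ; k = count X z
    τ-cancels : shapeSignˡ i j k (label N A) ++ shapeSignˡ i j k (τ (label N A)) ≈ []
    τ-cancels with (i , j , k) ≟₃ (1 , 1 , 0)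
    ... | yes _ = π-rel (label N A)
    ... | no _ with (i , j , k) ≟₃ (0 , 1 , 1)
    ...   | yes _ = π-rel⁻¹ (label N A)
    ...   | no _ = π-refl

cong-++₁₀ : {X : Set} {p₁ p₂ p₃ p₄ p₅ p₆ p₇ p₈ p₉ p₁₀ q₁ q₂ q₃ q₄ q₅ q₆ q₇ q₈ q₉ q₁₀ : List X} →
            p₁ ≡ q₁ → p₂ ≡ q₂ → p₃ ≡ q₃ → p₄ ≡ q₄ → p₅ ≡ q₅ → p₆ ≡ q₆ → p₇ ≡ q₇ → p₈ ≡ q₈ → p₉ ≡ q₉ → p₁₀ ≡ q₁₀ →
            p₁ ++ p₂ ++ p₃ ++ p₄ ++ p₅ ++ p₆ ++ p₇ ++ p₈ ++ p₉ ++ p₁₀ ≡ q₁ ++ q₂ ++ q₃ ++ q₄ ++ q₅ ++ q₆ ++ q₇ ++ q₈ ++ q₉ ++ q₁₀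
cong-++₁₀ refl refl refl refl refl refl refl refl refl refl = refl

replicate-++ : {A : Set} (i j : ℕ) (X : A) → replicate i X ++ replicate j X ≡ replicate (i + j) X
replicate-++ zero j X = refl
replicate-++ (suc i) j X = cong (X ∷_) (replicate-++ i j X)

count-filterᵇ-rejected : {m : ℕ} (d : Fin m → Bool) (X : Fin m) → d X ≡ false → (w : List (Fin m)) → count X (filterᵇ d w) ≡ 0
count-filterᵇ-rejected d X p [] = refl
count-filterᵇ-rejected d X p (Y ∷ w) with d Y in dY
... | false = count-filterᵇ-rejected d X p w
... | true with X ≟ Y
...   | yes refl with () ← trans (sym p) dY
...   | no ne = trans (count-there (filterᵇ d w) (λ q → ne (sym q))) (count-filterᵇ-rejected d X p w)

record Absent {m : ℕ} (X : Fin m) (x y z t : List (Fin m)) : Set where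
  constructor absent
  field
    from-x : count X x ≡ 0
    from-y : count X y ≡ 0
    from-z : count X z ≡ 0
    from-t : count X t ≡ 0
open Absent

module Move3Subwords {α : Set} (N : Nanoword α) (A B C : Fin (n N)) (x y z t : List (Fin (n N)))
                     (A≢B : A ≢ B) (A≢C : A ≢ C) (B≢C : B ≢ C) (wEq : word N ≡ move3-before x y z t A B C) where

  before after : List (Fin (n N))
  before = move3-before x y z t A B C
  after = move3-after x y z t A B C

  private
    B≢A = λ (p : B ≡ A) → A≢B (sym p)
    C≢A = λ (p : C ≡ A) → A≢C (sym p)
    C≢B = λ (p : C ≡ B) → B≢C (sym p)

    twice-before : (X : Fin (n N)) → count X before ≡ 2
    twice-before X = trans (cong (count X) (sym wEq)) (twice N X)

    occurrences : ∀ X → count X x + (indicator X A + (indicator X B + (count X y + (indicator X A + (indicator X C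
                          + (count X z + (indicator X B + (indicator X C + count X t)))))))) ≡ 2
    occurrences X = trans (sym (count-move3-before X A B C x y z t)) (twice-before X)

  absentA : Absent A x y z t
  absentA with +₄≡0 (count A x) (count A y) (count A z) (count A t)
                  (suc-suc-injective (trans (sym (normalise (count A x) (count A y) (count A z) (count A t))) (trans (sym indicators) (occurrences A))))
    where
    normalise : ∀ a b c d → a + suc (b + suc (c + d)) ≡ suc (suc (a + (b + (c + d))))
    normalise = solve-∀
    indicators : count A x + (indicator A A + (indicator A B + (count A y + (indicator A A + (indicator A C
                   + (count A z + (indicator A B + (indicator A C + count A t)))))))) ≡ count A x + suc (count A y + suc (count A z + count A t))
    indicators rewrite indicator-self A | indicator-other A B B≢A | indicator-other A C C≢A = refl
  ... | a , b , c , d = absent a b c d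

  absentB : Absent B x y z t
  absentB with +₄≡0 (count B x) (count B y) (count B z) (count B t)
                  (suc-suc-injective (trans (sym (normalise (count B x) (count B y) (count B z) (count B t))) (trans (sym indicators) (occurrences B))))
    where
    normalise : ∀ a b c d → a + suc (b + (c + suc d)) ≡ suc (suc (a + (b + (c + d))))
    normalise = solve-∀
    indicators : count B x + (indicator B A + (indicator B B + (count B y + (indicator B A + (indicator B C
                   + (count B z + (indicator B B + (indicator B C + count B t)))))))) ≡ count B x + suc (count B y + (count B z + suc (count B t)))
    indicators rewrite indicator-self B | indicator-other B A A≢B | indicator-other B C C≢B = refl
  ... | a , b , c , d = absent a b c d

  absentC : Absent C x y z t
  absentC with +₄≡0 (count C x) (count C y) (count C z) (count C t)
                  (suc-suc-injective (trans (sym (normalise (count C x) (count C y) (count C z) (count C t))) (trans (sym indicators) (occurrences C))))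
    where
    normalise : ∀ a b c d → a + (b + suc (c + suc d)) ≡ suc (suc (a + (b + (c + d))))
    normalise = solve-∀
    indicators : count C x + (indicator C A + (indicator C B + (count C y + (indicator C A + (indicator C C
                   + (count C z + (indicator C B + (indicator C C + count C t)))))))) ≡ count C x + (count C y + suc (count C z + suc (count C t)))
    indicators rewrite indicator-self C | indicator-other C A A≢C | indicator-other C B B≢C = refl
  ... | a , b , c , d = absent a b c d

  outside-occurrences : (E : Fin (n N)) → E ≢ A → E ≢ B → E ≢ C → count E x + (count E y + (count E z + count E t)) ≡ 2
  outside-occurrences E eA eB eC = trans (sym indicators) (occurrences E)
    where
    indicators : count E x + (indicator E A + (indicator E B + (count E y + (indicator E A + (indicator E C
                   + (count E z + (indicator E B + (indicator E C + count E t)))))))) ≡ count E x + (count E y + (count E z + count E t))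
    indicators rewrite indicator-other E A (λ p → eA (sym p)) | indicator-other E B (λ p → eB (sym p))
                     | indicator-other E C (λ p → eC (sym p)) = refl

  private
    pieces-before : (P Q : Fin (n N)) → patternAB P Q before ≡
      patternAB P Q x ++ patternAB P Q [ A ] ++ patternAB P Q [ B ] ++ patternAB P Q y ++ patternAB P Q [ A ] ++
      patternAB P Q [ C ] ++ patternAB P Q z ++ patternAB P Q [ B ] ++ patternAB P Q [ C ] ++ patternAB P Q t
    pieces-before P Q
      rewrite patternAB-++ P Q x (A ∷ B ∷ y ++ A ∷ C ∷ z ++ B ∷ C ∷ t) | patternAB-++ P Q [ A ] (B ∷ y ++ A ∷ C ∷ z ++ B ∷ C ∷ t)
            | patternAB-++ P Q [ B ] (y ++ A ∷ C ∷ z ++ B ∷ C ∷ t) | patternAB-++ P Q y (A ∷ C ∷ z ++ B ∷ C ∷ t)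
            | patternAB-++ P Q [ A ] (C ∷ z ++ B ∷ C ∷ t) | patternAB-++ P Q [ C ] (z ++ B ∷ C ∷ t) | patternAB-++ P Q z (B ∷ C ∷ t)
            | patternAB-++ P Q [ B ] (C ∷ t) | patternAB-++ P Q [ C ] t = refl

    pieces-after : (P Q : Fin (n N)) → patternAB P Q after ≡
      patternAB P Q x ++ patternAB P Q [ B ] ++ patternAB P Q [ A ] ++ patternAB P Q y ++ patternAB P Q [ C ] ++
      patternAB P Q [ A ] ++ patternAB P Q z ++ patternAB P Q [ C ] ++ patternAB P Q [ B ] ++ patternAB P Q t
    pieces-after P Q
      rewrite patternAB-++ P Q x (B ∷ A ∷ y ++ C ∷ A ∷ z ++ C ∷ B ∷ t) | patternAB-++ P Q [ B ] (A ∷ y ++ C ∷ A ∷ z ++ C ∷ B ∷ t)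
            | patternAB-++ P Q [ A ] (y ++ C ∷ A ∷ z ++ C ∷ B ∷ t) | patternAB-++ P Q y (C ∷ A ∷ z ++ C ∷ B ∷ t)
            | patternAB-++ P Q [ C ] (A ∷ z ++ C ∷ B ∷ t) | patternAB-++ P Q [ A ] (z ++ C ∷ B ∷ t) | patternAB-++ P Q z (C ∷ B ∷ t)
            | patternAB-++ P Q [ C ] (B ∷ t) | patternAB-++ P Q [ B ] t = refl

    ∅x : {P Q : Fin (n N)} → Absent P x y z t → Absent Q x y z t → patternAB P Q x ≡ []
    ∅x aP aQ = patternAB-absent _ _ x (from-x aP) (from-x aQ)
    ∅y : {P Q : Fin (n N)} → Absent P x y z t → Absent Q x y z t → patternAB P Q y ≡ []
    ∅y aP aQ = patternAB-absent _ _ y (from-y aP) (from-y aQ)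
    ∅z : {P Q : Fin (n N)} → Absent P x y z t → Absent Q x y z t → patternAB P Q z ≡ []
    ∅z aP aQ = patternAB-absent _ _ z (from-z aP) (from-z aQ)
    ∅t : {P Q : Fin (n N)} → Absent P x y z t → Absent Q x y z t → patternAB P Q t ≡ []
    ∅t aP aQ = patternAB-absent _ _ t (from-t aP) (from-t aQ)

  subword-before-AB : patternAB A B before ≡ A ∷ B ∷ A ∷ B ∷ []
  subword-before-AB = trans (pieces-before A B)
    (cong-++₁₀ (∅x absentA absentB) (patternAB-[P] A B) (patternAB-[Q] A B) (∅y absentA absentB) (patternAB-[P] A B)
               (patternAB-[Z] A B C C≢A C≢B) (∅z absentA absentB) (patternAB-[Q] A B) (patternAB-[Z] A B C C≢A C≢B) (∅t absentA absentB))

  subword-after-AB : patternAB A B after ≡ B ∷ A ∷ A ∷ B ∷ []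
  subword-after-AB = trans (pieces-after A B)
    (cong-++₁₀ (∅x absentA absentB) (patternAB-[Q] A B) (patternAB-[P] A B) (∅y absentA absentB) (patternAB-[Z] A B C C≢A C≢B)
               (patternAB-[P] A B) (∅z absentA absentB) (patternAB-[Z] A B C C≢A C≢B) (patternAB-[Q] A B) (∅t absentA absentB))

  subword-before-AC : patternAB A C before ≡ A ∷ A ∷ C ∷ C ∷ []
  subword-before-AC = trans (pieces-before A C)
    (cong-++₁₀ (∅x absentA absentC) (patternAB-[P] A C) (patternAB-[Z] A C B B≢A B≢C) (∅y absentA absentC) (patternAB-[P] A C)
               (patternAB-[Q] A C) (∅z absentA absentC) (patternAB-[Z] A C B B≢A B≢C) (patternAB-[Q] A C) (∅t absentA absentC))

  subword-after-AC : patternAB A C after ≡ A ∷ C ∷ A ∷ C ∷ []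
  subword-after-AC = trans (pieces-after A C)
    (cong-++₁₀ (∅x absentA absentC) (patternAB-[Z] A C B B≢A B≢C) (patternAB-[P] A C) (∅y absentA absentC) (patternAB-[Q] A C)
               (patternAB-[P] A C) (∅z absentA absentC) (patternAB-[Q] A C) (patternAB-[Z] A C B B≢A B≢C) (∅t absentA absentC))

  subword-before-BC : patternAB B C before ≡ B ∷ C ∷ B ∷ C ∷ []
  subword-before-BC = trans (pieces-before B C)
    (cong-++₁₀ (∅x absentB absentC) (patternAB-[Z] B C A A≢B A≢C) (patternAB-[P] B C) (∅y absentB absentC) (patternAB-[Z] B C A A≢B A≢C)
               (patternAB-[Q] B C) (∅z absentB absentC) (patternAB-[P] B C) (patternAB-[Q] B C) (∅t absentB absentC))

  subword-after-BC : patternAB B C after ≡ B ∷ C ∷ C ∷ B ∷ []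
  subword-after-BC = trans (pieces-after B C)
    (cong-++₁₀ (∅x absentB absentC) (patternAB-[P] B C) (patternAB-[Z] B C A A≢B A≢C) (∅y absentB absentC) (patternAB-[Q] B C)
               (patternAB-[Z] B C A A≢B A≢C) (∅z absentB absentC) (patternAB-[Q] B C) (patternAB-[P] B C) (∅t absentB absentC))

  subword-before-AA : patternAB A A before ≡ A ∷ A ∷ []
  subword-before-AA = trans (pieces-before A A)
    (cong-++₁₀ (∅x absentA absentA) (patternAB-[P] A A) (patternAB-[Z] A A B B≢A B≢A) (∅y absentA absentA) (patternAB-[P] A A)
               (patternAB-[Z] A A C C≢A C≢A) (∅z absentA absentA) (patternAB-[Z] A A B B≢A B≢A) (patternAB-[Z] A A C C≢A C≢A) (∅t absentA absentA))

  subword-before-BB : patternAB B B before ≡ B ∷ B ∷ []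
  subword-before-BB = trans (pieces-before B B)
    (cong-++₁₀ (∅x absentB absentB) (patternAB-[Z] B B A A≢B A≢B) (patternAB-[P] B B) (∅y absentB absentB) (patternAB-[Z] B B A A≢B A≢B)
               (patternAB-[Z] B B C C≢B C≢B) (∅z absentB absentB) (patternAB-[P] B B) (patternAB-[Z] B B C C≢B C≢B) (∅t absentB absentB))

  subword-before-CC : patternAB C C before ≡ C ∷ C ∷ []
  subword-before-CC = trans (pieces-before C C)
    (cong-++₁₀ (∅x absentC absentC) (patternAB-[Z] C C A A≢C A≢C) (patternAB-[Z] C C B B≢C B≢C) (∅y absentC absentC) (patternAB-[Z] C C A A≢C A≢C)
               (patternAB-[P] C C) (∅z absentC absentC) (patternAB-[Z] C C B B≢C B≢C) (patternAB-[P] C C) (∅t absentC absentC))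

  module _ (E : Fin (n N)) (E≢A : E ≢ A) (E≢B : E ≢ B) (E≢C : E ≢ C) where
    private
      A≢E = λ (p : A ≡ E) → E≢A (sym p)
      B≢E = λ (p : B ≡ E) → E≢B (sym p)
      C≢E = λ (p : C ≡ E) → E≢C (sym p)
      cx = count E x ; cy = count E y ; cz = count E z ; ct = count E t

    subword-before-AE : patternAB A E before ≡ shape E A cx cy (cz + ct)
    subword-before-AE = trans (pieces-before A E) (trans
      (cong-++₁₀ (patternAB-replicateʳ A E x (from-x absentA)) (patternAB-[P] A E) (patternAB-[Z] A E B B≢A B≢E)
                 (patternAB-replicateʳ A E y (from-y absentA)) (patternAB-[P] A E) (patternAB-[Z] A E C C≢A C≢E)
                 (patternAB-replicateʳ A E z (from-z absentA)) (patternAB-[Z] A E B B≢A B≢E) (patternAB-[Z] A E C C≢A C≢E)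
                 (patternAB-replicateʳ A E t (from-t absentA)))
      (cong (λ l → replicate cx E ++ A ∷ replicate cy E ++ A ∷ l) (replicate-++ cz ct E)))

    subword-before-BE : patternAB B E before ≡ shape E B cx (cy + cz) ct
    subword-before-BE = trans (pieces-before B E) (trans
      (cong-++₁₀ (patternAB-replicateʳ B E x (from-x absentB)) (patternAB-[Z] B E A A≢B A≢E) (patternAB-[P] B E)
                 (patternAB-replicateʳ B E y (from-y absentB)) (patternAB-[Z] B E A A≢B A≢E) (patternAB-[Z] B E C C≢B C≢E)
                 (patternAB-replicateʳ B E z (from-z absentB)) (patternAB-[P] B E) (patternAB-[Z] B E C C≢B C≢E)
                 (patternAB-replicateʳ B E t (from-t absentB)))
      (cong (λ l → replicate cx E ++ B ∷ l) (trans (sym (++-assoc (replicate cy E) (replicate cz E) (B ∷ replicate ct E)))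
         (cong (_++ B ∷ replicate ct E) (replicate-++ cy cz E)))))

    subword-before-CE : patternAB C E before ≡ shape E C (cx + cy) cz ct
    subword-before-CE = trans (pieces-before C E) (trans
      (cong-++₁₀ (patternAB-replicateʳ C E x (from-x absentC)) (patternAB-[Z] C E A A≢C A≢E) (patternAB-[Z] C E B B≢C B≢E)
                 (patternAB-replicateʳ C E y (from-y absentC)) (patternAB-[Z] C E A A≢C A≢E) (patternAB-[P] C E)
                 (patternAB-replicateʳ C E z (from-z absentC)) (patternAB-[Z] C E B B≢C B≢E) (patternAB-[P] C E)
                 (patternAB-replicateʳ C E t (from-t absentC)))
      (trans (sym (++-assoc (replicate cx E) (replicate cy E) (C ∷ replicate cz E ++ C ∷ replicate ct E)))
         (cong (_++ C ∷ replicate cz E ++ C ∷ replicate ct E) (replicate-++ cx cy E))))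

  subword-unchanged : (P Q R : Fin (n N)) → (∀ {X} → (X ≡ P) ⊎ (X ≡ Q) → (X ≡ A) ⊎ (X ≡ B) ⊎ (X ≡ C) → X ≡ R) →
                      patternAB P Q before ≡ patternAB P Q after
  subword-unchanged P Q R onlyR = filter-move3 (oneOf? P Q) x y z t
    (λ { (a , b) → A≢B (trans (onlyR a (inj₁ refl)) (sym (onlyR b (inj₂ (inj₁ refl))))) })
    (λ { (a , c) → A≢C (trans (onlyR a (inj₁ refl)) (sym (onlyR c (inj₂ (inj₂ refl))))) })
    (λ { (b , c) → B≢C (trans (onlyR b (inj₂ (inj₁ refl))) (sym (onlyR c (inj₂ (inj₂ refl))))) })

  subword-unchanged-self : (P : Fin (n N)) → patternAB P P before ≡ patternAB P P after
  subword-unchanged-self P = subword-unchanged P P P (λ { (inj₁ p) _ → p ; (inj₂ p) _ → p })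

  subword-unchanged-outside : (P Q : Fin (n N)) → Q ≢ A → Q ≢ B → Q ≢ C → patternAB P Q before ≡ patternAB P Q after
  subword-unchanged-outside P Q qA qB qC = subword-unchanged P Q P only
    where
    only : ∀ {X} → (X ≡ P) ⊎ (X ≡ Q) → (X ≡ A) ⊎ (X ≡ B) ⊎ (X ≡ C) → X ≡ P
    only (inj₁ p) _ = p
    only (inj₂ refl) (inj₁ refl) = ⊥-elim (qA refl)
    only (inj₂ refl) (inj₂ (inj₁ refl)) = ⊥-elim (qB refl)
    only (inj₂ refl) (inj₂ (inj₂ refl)) = ⊥-elim (qC refl)

  contrib-before contrib-after : Fin (n N) → Fin (n N) → List (α × Bool)
  contrib-before P Q = contribution (patternAB P Q before) P Q (label N Q)
  contrib-after P Q = contribution (patternAB P Q after) P Q (label N Q)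

  isOutside : Fin (n N) → Bool
  isOutside X = isNot A X ∧ (isNot B X ∧ isNot C X)

  outside : List (Fin (n N))
  outside = filterᵇ isOutside (allFin (n N))

  isOutside⇒≢ : ∀ X → isOutside X ≡ true → X ≢ A × X ≢ B × X ≢ C
  isOutside⇒≢ X p with isNot A X in eA | isNot B X in eB | isNot C X in eC
  ... | true | true | true = isNot-true⁻ A X eA , isNot-true⁻ B X eB , isNot-true⁻ C X eC

  counts-ABC-outside : ∀ X → count X (allFin (n N)) ≡ count X (A ∷ B ∷ C ∷ outside)
  counts-ABC-outside X = trans (count-allFin (n N) X) (sym (begin
    count X (A ∷ B ∷ C ∷ outside)                                               ≡⟨ count-∷ X A _ ⟩
    indicator X A + count X (B ∷ C ∷ outside)                                   ≡⟨ cong (indicator X A +_) (count-∷ X B _) ⟩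
    indicator X A + (indicator X B + count X (C ∷ outside))                     ≡⟨ cong (λ k → indicator X A + (indicator X B + k)) (count-∷ X C _) ⟩
    indicator X A + (indicator X B + (indicator X C + count X outside))         ≡⟨ once X ⟩
    1                                                                           ∎))
    where
    open ≡-Reasoning
    rejected : ∀ X → isOutside X ≡ false → count X outside ≡ 0
    rejected X p = count-filterᵇ-rejected isOutside X p (allFin (n N))
    once : ∀ X → indicator X A + (indicator X B + (indicator X C + count X outside)) ≡ 1
    once X with X ≟ A | X ≟ B | X ≟ C
    ... | yes refl | _ | _ rewrite indicator-self A | indicator-other A B B≢A | indicator-other A C C≢A =
      cong suc (rejected A (cong (_∧ (isNot B A ∧ isNot C A)) (isNot-self A)))
    ... | no _ | yes refl | _ rewrite indicator-self B | indicator-other B A A≢B | indicator-other B C C≢B =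
      cong suc (rejected B (trans (cong (_∧ (isNot B B ∧ isNot C B)) (isNot-true A B B≢A)) (cong (_∧ isNot C B) (isNot-self B))))
    ... | no _ | no _ | yes refl rewrite indicator-self C | indicator-other C A A≢C | indicator-other C B B≢C =
      cong suc (rejected C (trans (cong (_∧ (isNot B C ∧ isNot C C)) (isNot-true A C C≢A))
                             (trans (cong (_∧ isNot C C) (isNot-true B C C≢B)) (isNot-self C))))
    ... | no xA | no xB | no xC
      rewrite indicator-other X A (λ p → xA (sym p)) | indicator-other X B (λ p → xB (sym p)) | indicator-other X C (λ p → xC (sym p)) =
      trans (count-filterᵇ isOutside X (trans (cong (_∧ (isNot B X ∧ isNot C X)) (isNot-true A X xA))
                                        (trans (cong (_∧ isNot C X) (isNot-true B X xB)) (isNot-true C X xC))) (allFin (n N)))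
            (count-allFin (n N) X)

module ShapeSigns {α : Set} (τ : α → α) where
  open PiGroup τ

  -- Splitting the block of letters between the two occurrences of E: a finite check over the compositions of 2.
  shapeSign-split : (a b c d : ℕ) (g : α) → a + (b + (c + d)) ≡ 2 →
                    shapeSignʳ a (b + c) d g ≈ shapeSignʳ a b (c + d) g ++ shapeSignʳ (a + b) c d g
  shapeSign-split 0 0 0 d g refl = π-refl
  shapeSign-split 0 0 1 d g refl = π-refl
  shapeSign-split 0 0 2 d g refl = π-refl
  shapeSign-split 0 0 (suc (suc (suc c))) d g ()
  shapeSign-split 0 1 0 d g refl = π-refl
  shapeSign-split 0 1 1 d g refl = π-sym (invert-inverseʳ (g , true))
  shapeSign-split 0 1 (suc (suc c)) d g ()
  shapeSign-split 0 2 0 d g refl = π-refl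
  shapeSign-split 0 2 (suc c) d g ()
  shapeSign-split 0 (suc (suc (suc b))) c d g ()
  shapeSign-split 1 0 0 d g refl = π-refl
  shapeSign-split 1 0 1 d g refl = π-refl
  shapeSign-split 1 0 (suc (suc c)) d g ()
  shapeSign-split 1 1 0 d g refl = π-refl
  shapeSign-split 1 1 (suc c) d g ()
  shapeSign-split 1 (suc (suc b)) c d g ()
  shapeSign-split 2 0 0 d g refl = π-refl
  shapeSign-split 2 0 (suc c) d g ()
  shapeSign-split 2 (suc b) c d g ()
  shapeSign-split (suc (suc (suc a))) b c d g ()

module Move3Brackets {α : Set} (τ : α → α) (N : Nanoword α) (A B C : Fin (n N)) (x y z t : List (Fin (n N)))
                     (A≢B : A ≢ B) (A≢C : A ≢ C) (B≢C : B ≢ C) (wEq : word N ≡ move3-before x y z t A B C)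
                     (lAB : label N A ≡ label N B) (lBC : label N B ≡ label N C) where
  open PiGroup τ
  open Products τ
  open ShapeSigns τ
  open Move3Subwords N A B C x y z t A≢B A≢C B≢C wEq

  private
    B≢A = λ (p : B ≡ A) → A≢B (sym p)
    C≢A = λ (p : C ≡ A) → A≢C (sym p)
    C≢B = λ (p : C ≡ B) → B≢C (sym p)

    split : (f : Fin (n N) → PiWord τ) → concatMap f (allFin (n N)) ≈ f A ++ (f B ++ (f C ++ concatMap f outside))
    split f = concatMap-sameCount f (allFin (n N)) (A ∷ B ∷ C ∷ outside) counts-ABC-outside

    outside-unchanged : (P : Fin (n N)) → concatMap (contrib-after P) outside ≈ concatMap (contrib-before P) outside
    outside-unchanged P = concatMap-filterᵇ-cong-≈ isOutside (contrib-after P) (contrib-before P) (allFin (n N)) λ Q q →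
      let (qA , qB , qC) = isOutside⇒≢ Q q in ≡⇒≈ (cong (λ l → contribution l P Q (label N Q)) (sym (subword-unchanged-outside P Q qA qB qC)))

    self-unchanged : (P : Fin (n N)) → contrib-after P P ≡ contrib-before P P
    self-unchanged P = cong (λ l → contribution l P P (label N P)) (sym (subword-unchanged-self P))

    value : ∀ {P Q l v} → patternAB P Q before ≡ l → contribution l P Q (label N Q) ≡ v → contrib-before P Q ≡ v
    value {P} {Q} eq c = trans (cong (λ l → contribution l P Q (label N Q)) eq) c

    value-after : ∀ {P Q l v} → patternAB P Q after ≡ l → contribution l P Q (label N Q) ≡ v → contrib-after P Q ≡ v
    value-after {P} {Q} eq c = trans (cong (λ l → contribution l P Q (label N Q)) eq) c

  bracket-before bracket-after : Fin (n N) → PiWord τ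
  bracket-before P = concatMap (contrib-before P) (allFin (n N))
  bracket-after P = concatMap (contrib-after P) (allFin (n N))

  -- Before the move A meets B and not C; after it, C and not B. Since |B| = |C| this does not change [A].
  bracket-unchanged-A : bracket-after A ≈ bracket-before A
  bracket-unchanged-A =
    split (contrib-after A)
    ⨾ π-cong (≡⇒≈ (self-unchanged A))
        (≡⇒≈ (cong₂ _++_ (value-after subword-after-AB (contribution-EDDE A B _ A≢B))
                         (cong (_++ concatMap (contrib-after A) outside) (value-after subword-after-AC (contribution-DEDE A C _))))
         ⨾ ≡⇒≈ (cong (λ a → (a , true) ∷ concatMap (contrib-after A) outside) (sym lBC))
         ⨾ ++-congˡ [ (label N B , true) ] (outside-unchanged A)
         ⨾ ≡⇒≈ (sym (cong₂ _++_ (value subword-before-AB (contribution-DEDE A B _))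
                                (cong (_++ concatMap (contrib-before A) outside) (value subword-before-AC (contribution-DDEE A C _ A≢C))))))
    ⨾ π-sym (split (contrib-before A))

  bracket-unchanged-B : bracket-after B ≈ bracket-before B
  bracket-unchanged-B =
    split (contrib-after B)
    ⨾ ≡⇒≈ (cong₂ _++_ (value-after (trans (patternAB-sym B A after) subword-after-AB) (contribution-DEED B A _ B≢A))
                      (cong (contrib-after B B ++_) (cong (_++ concatMap (contrib-after B) outside) (value-after subword-after-BC (contribution-DEED B C _ B≢C)))))
    ⨾ π-cong (≡⇒≈ (self-unchanged B)) (outside-unchanged B)
    ⨾ π-sym (cancel-pair (label N A , false) (label N C , true) (contrib-before B B) (concatMap (contrib-before B) outside)
               (≡⇒≈ (cong (λ a → (label N A , false) ∷ (a , true) ∷ []) (sym (trans lAB lBC))) ⨾ invert-inverseˡ (label N A , true)))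
    ⨾ ≡⇒≈ (sym (cong₂ _++_ (value (trans (patternAB-sym B A before) subword-before-AB) (contribution-EDED B A _ B≢A))
                           (cong (contrib-before B B ++_) (cong (_++ concatMap (contrib-before B) outside) (value subword-before-BC (contribution-DEDE B C _))))))
    ⨾ π-sym (split (contrib-before B))

  bracket-unchanged-C : bracket-after C ≈ bracket-before C
  bracket-unchanged-C =
    split (contrib-after C)
    ⨾ ≡⇒≈ (cong₂ _++_ (value-after (trans (patternAB-sym C A after) subword-after-AC) (contribution-EDED C A _ C≢A))
                      (cong (_++ (contrib-after C C ++ concatMap (contrib-after C) outside)) (value-after (trans (patternAB-sym C B after) subword-after-BC) (contribution-EDDE C B _ C≢B))))
    ⨾ ≡⇒≈ (cong (λ a → (a , false) ∷ (contrib-after C C ++ concatMap (contrib-after C) outside)) lAB)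
    ⨾ ++-congˡ [ (label N B , false) ] (π-cong (≡⇒≈ (self-unchanged C)) (outside-unchanged C))
    ⨾ ≡⇒≈ (sym (cong₂ _++_ (value (trans (patternAB-sym C A before) subword-before-AC) (contribution-EEDD C A _ C≢A))
                           (cong (_++ (contrib-before C C ++ concatMap (contrib-before C) outside)) (value (trans (patternAB-sym C B before) subword-before-BC) (contribution-EDED C B _ C≢B)))))
    ⨾ π-sym (split (contrib-before C))

  bracket-unchanged : (P : Fin (n N)) → bracket-after P ≈ bracket-before P
  bracket-unchanged P with P ≟ A | P ≟ B | P ≟ C
  ... | yes refl | _ | _ = bracket-unchanged-A
  ... | no _ | yes refl | _ = bracket-unchanged-B
  ... | no _ | no _ | yes refl = bracket-unchanged-C
  ... | no pA | no pB | no pC = concatMap-cong-≈ (contrib-after P) (contrib-before P) (allFin (n N))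
    λ Q → ≡⇒≈ (cong (λ l → contribution l P Q (label N Q))
                 (sym (trans (patternAB-sym P Q before) (trans (subword-unchanged-outside Q P pA pB pC) (patternAB-sym Q P after)))))

  -- On the letters other than A, B, C this is shapeSign-split.
  bracket-B≈A∙C : bracket-before B ≈ bracket-before A ++ bracket-before C
  bracket-B≈A∙C =
    split (contrib-before B)
    ⨾ ≡⇒≈ (cong₂ _++_ (value (trans (patternAB-sym B A before) subword-before-AB) (contribution-EDED B A _ B≢A))
                      (cong₂ _++_ (value subword-before-BB (contribution-DD B _)) (cong (_++ concatMap (contrib-before B) outside) (value subword-before-BC (contribution-DEDE B C _)))))
    ⨾ cancel-pair (label N A , false) (label N C , true) [] (concatMap (contrib-before B) outside)
        (≡⇒≈ (cong (λ a → (label N A , false) ∷ (a , true) ∷ []) (sym (trans lAB lBC))) ⨾ invert-inverseˡ (label N A , true))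
    ⨾ concatMap-filterᵇ-cong-≈ isOutside (contrib-before B) (λ E → contrib-before A E ++ contrib-before C E) (allFin (n N)) outsideB
    ⨾ concatMap-++-≈ (contrib-before A) (contrib-before C) outside
    ⨾ π-sym (cancel-pair (label N B , true) (label N B , false) (concatMap (contrib-before A) outside) (concatMap (contrib-before C) outside)
               (invert-inverseʳ (label N B , true)))
    ⨾ ≡⇒≈ (sym (cong₂ _++_
        (cong₂ _++_ (value subword-before-AA (contribution-DD A _))
          (cong₂ _++_ (value subword-before-AB (contribution-DEDE A B _)) (cong (_++ concatMap (contrib-before A) outside) (value subword-before-AC (contribution-DDEE A C _ A≢C)))))
        (cong₂ _++_ (value (trans (patternAB-sym C A before) subword-before-AC) (contribution-EEDD C A _ C≢A))
          (cong₂ _++_ (value (trans (patternAB-sym C B before) subword-before-BC) (contribution-EDED C B _ C≢B))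
            (cong (_++ concatMap (contrib-before C) outside) (value subword-before-CC (contribution-DD C _)))))))
    ⨾ π-cong (π-sym (split (contrib-before A))) (π-sym (split (contrib-before C)))
    where
    outsideB : ∀ E → isOutside E ≡ true → contrib-before B E ≈ contrib-before A E ++ contrib-before C E
    outsideB E q with isOutside⇒≢ E q
    ... | eA , eB , eC =
      ≡⇒≈ (value (subword-before-BE E eA eB eC) (contribution-shapeʳ E B (λ p → eB (sym p)) _ _ _ _))
      ⨾ shapeSign-split (count E x) (count E y) (count E z) (count E t) (label N E) (outside-occurrences E eA eB eC)
      ⨾ ≡⇒≈ (sym (cong₂ _++_ (value (subword-before-AE E eA eB eC) (contribution-shapeʳ E A (λ p → eA (sym p)) _ _ _ _))
                             (value (subword-before-CE E eA eB eC) (contribution-shapeʳ E C (λ p → eC (sym p)) _ _ _ _))))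

filterᵇ-true : {A : Set} (w : List A) → filterᵇ (λ _ → true) w ≡ w
filterᵇ-true [] = refl
filterᵇ-true (x ∷ w) = cong (x ∷_) (filterᵇ-true w)

module StepBrackets {α : Set} (τ : α → α) where
  open PiGroup τ
  open Products τ
  open BracketRestriction τ

  bracket-iso : {N N' : Nanoword α} → ((e , _) : Iso N N') → ∀ B → bracket N' B ≈ bracket N (e B)
  bracket-iso {N} {N'} (e , inj , onto , lab , w) B =
    bracket-reindex N N' e [] (allFin-counts e inj [] (λ X → inj₁ (onto X , refl))) B
      (contrib-restriction N N' e inj lab (λ _ → true) (λ _ → refl) (trans w (sym (filterᵇ-true (word N)))) B) π-refl

  bracket-move1 : {N N' : Nanoword α} (A : Fin (n N)) (x y : List (Fin (n N))) → word N ≡ x ++ A ∷ A ∷ y →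
                  ((e , _) : Restriction N N' (λ X → X ≢ A)) → ∀ B → bracket N' B ≈ bracket N (e B)
  bracket-move1 {N} {N'} A x y wEq r@(e , inj , lab , onto , _) B =
    bracket-reindex N N' e [ A ] counts B
      (contrib-restriction N N' e inj lab (isNot A) (λ b → isNot-true A (e b) (image b))
        (Restriction-word {N = N} {N'} (isNot A) (isNot-restriction {N = N} {N'} r)) B)
      (≡⇒≈ (cong (_++ []) (move1-contrib≡[] N A x y wEq (e B) (image B))))
    where
    image : ∀ b → e b ≢ A
    image = Restriction-image {N = N} {N'} r
    counts = allFin-counts e inj [ A ] λ X → case X
      where
      case : ∀ X → (Σ _ (λ b → e b ≡ X) × count X [ A ] ≡ 0) ⊎ ((∀ b → e b ≢ X) × count X [ A ] ≡ 1)
      case X with X ≟ A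
      ... | yes refl = inj₂ (image , count-here A [])
      ... | no ne = inj₁ (onto X ne , count-there [] (λ p → ne (sym p)))

  bracket-move2 : {N N' : Nanoword α} (A B : Fin (n N)) (x y z : List (Fin (n N))) →
                  word N ≡ x ++ A ∷ B ∷ y ++ B ∷ A ∷ z → label N B ≡ τ (label N A) →
                  ((e , _) : Restriction N N' (λ X → X ≢ A × X ≢ B)) → ∀ B' → bracket N' B' ≈ bracket N (e B')
  bracket-move2 {N} {N'} A B x y z wEq lAB r@(e , inj , lab , onto , _) B' =
    bracket-reindex N N' e (A ∷ B ∷ []) counts B'
      (contrib-restriction N N' e inj lab (λ X → isNot A X ∧ isNot B X)
        (λ b → cong₂ _∧_ (isNot-true A (e b) (proj₁ (image b))) (isNot-true B (e b) (proj₂ (image b))))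
        (Restriction-word {N = N} {N'} _ (isNot₂-restriction {N = N} {N'} r)) B')
      (≡⇒≈ (cong (contrib N (e B') A ++_) (++-identityʳ _))
       ⨾ move2-contribs-cancel N A B x y z wEq lAB (e B') (proj₁ (image B')) (proj₂ (image B')))
    where
    open Move2Subwords N A B x y z wEq using (A≢B)
    image : ∀ b → e b ≢ A × e b ≢ B
    image = Restriction-image {N = N} {N'} r
    counts = allFin-counts e inj (A ∷ B ∷ []) λ X → case X
      where
      case : ∀ X → (Σ _ (λ b → e b ≡ X) × count X (A ∷ B ∷ []) ≡ 0) ⊎ ((∀ b → e b ≢ X) × count X (A ∷ B ∷ []) ≡ 1)
      case X with X ≟ A | X ≟ B
      ... | yes refl | _ = inj₂ ((λ b → proj₁ (image b)) , trans (count-here A [ B ]) (cong suc (count-there [] (λ p → A≢B (sym p)))))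
      ... | no _ | yes refl = inj₂ ((λ b → proj₂ (image b)) , trans (count-there [ B ] A≢B) (count-here B []))
      ... | no n₁ | no n₂ = inj₁ (onto X (n₁ , n₂) , trans (count-there [ B ] (λ p → n₁ (sym p))) (count-there [] (λ p → n₂ (sym p))))

  bracket-move2-AB : (N : Nanoword α) (A B : Fin (n N)) (x y z : List (Fin (n N))) →
                     word N ≡ x ++ A ∷ B ∷ y ++ B ∷ A ∷ z → bracket N A ≡ bracket N B
  bracket-move2-AB N A B x y z wEq = concatMap-cong (Move2Subwords.contrib-A≡contrib-B N A B x y z wEq) (allFin (n N))

  module _ {N : Nanoword α} (A B C : Fin (n N)) (x y z t : List (Fin (n N)))
           (A≢B : A ≢ B) (A≢C : A ≢ C) (B≢C : B ≢ C) (lAB : label N A ≡ label N B) (lBC : label N B ≡ label N C)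
           (wEq : word N ≡ move3-before x y z t A B C) where
    open Move3Subwords N A B C x y z t A≢B A≢C B≢C wEq using (contrib-before; contrib-after; after)
    open Move3Brackets τ N A B C x y z t A≢B A≢C B≢C wEq lAB lBC

    private
      bracket≡before : ∀ P → bracket N P ≡ bracket-before P
      bracket≡before P = concatMap-cong (λ Q → trans (contrib≡contribution N P Q)
                           (cong (λ l → contribution (patternAB P Q l) P Q (label N Q)) wEq)) (allFin (n N))

    bracket-move3 : {N' : Nanoword α} (e : Fin (n N') → Fin (n N)) → Injective _≡_ _≡_ e → (∀ D → ∃ λ D' → e D' ≡ D) →
                    (∀ D → label N (e D) ≡ label N' D) → map e (word N') ≡ after →
                    ∀ B' → bracket N' B' ≈ bracket N (e B')
    bracket-move3 {N'} e inj onto lab we B' =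
      ≡⇒≈ (concatMap-cong contrib-N' (allFin (n N')))
      ⨾ ≡⇒≈ (sym (concatMap-map (contrib-after (e B')) e (allFin (n N'))))
      ⨾ ≡⇒≈ (cong (concatMap (contrib-after (e B'))) (sym (++-identityʳ (map e (allFin (n N'))))))
      ⨾ π-sym (concatMap-sameCount (contrib-after (e B')) (allFin (n N)) (map e (allFin (n N')) ++ [])
                 (allFin-counts e inj [] (λ X → inj₁ (onto X , refl))))
      ⨾ bracket-unchanged (e B')
      ⨾ ≡⇒≈ (sym (bracket≡before (e B')))
      where
      contrib-N' : ∀ E' → contrib N' B' E' ≡ contrib-after (e B') (e E')
      contrib-N' E' = begin
        contrib N' B' E'                                                   ≡⟨ contrib≡contribution N' B' E' ⟩
        contribution (patternAB B' E' (word N')) B' E' (label N' E')       ≡⟨ sym (contribution-map e inj _ B' E' _) ⟩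
        contribution (map e (patternAB B' E' (word N'))) (e B') (e E') (label N' E')
          ≡⟨ cong (λ l → contribution l (e B') (e E') (label N' E')) (trans (patternAB-map e inj B' E' (word N')) (cong (patternAB (e B') (e E')) we)) ⟩
        contribution (patternAB (e B') (e E') after) (e B') (e E') (label N' E') ≡⟨ cong (contribution _ (e B') (e E')) (sym (lab E')) ⟩
        contrib-after (e B') (e E')                                        ∎
        where open ≡-Reasoning

    bracket-move3-B : bracket N B ≈ bracket N A ++ bracket N C
    bracket-move3-B = ≡⇒≈ (bracket≡before B) ⨾ bracket-B≈A∙C ⨾ ≡⇒≈ (sym (cong₂ _++_ (bracket≡before A) (bracket≡before C)))

-- The H-covering

module SubgroupProperties {α : Set} (τ : α → α) (S : Subgroup τ) where
  open PiGroup τ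

  ∈-product : ∀ {u v w} → u ≈ v ++ w → _∈H S v → _∈H S w → _∈H S u
  ∈-product eq v∈ w∈ = resp S (π-sym eq) (mul S v∈ w∈)

  ∈-right-factor : ∀ {u v w} → u ≈ v ++ w → _∈H S u → _∈H S v → _∈H S w
  ∈-right-factor {u} {v} {w} eq u∈ v∈ = resp S w≈ (mul S (inv S v∈) u∈)
    where
    w≈ : πinv τ v ++ u ≈ w
    w≈ = ++-congˡ (πinv τ v) eq ⨾ π-sym (++-assoc-≈ (πinv τ v) v w) ⨾ ++-congʳ w (πinv-inverseˡ v)

  ∈-left-factor : ∀ {u v w} → u ≈ v ++ w → _∈H S u → _∈H S w → _∈H S v
  ∈-left-factor {u} {v} {w} eq u∈ w∈ = ∈-right-factor (eq ⨾ ++-comm-≈ v w) u∈ w∈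

  notExactlyTwo-closed : ∀ {u v w} → v ≈ u ++ w → ∀ {a b c} →
                         (a ≡ true → _∈H S u) × (_∈H S u → a ≡ true) → (b ≡ true → _∈H S v) × (_∈H S v → b ≡ true) →
                         (c ≡ true → _∈H S w) × (_∈H S w → c ≡ true) → notExactlyTwo a b c ≡ true
  notExactlyTwo-closed eq {true} {true} {false} ra rb rc = proj₂ rc (∈-right-factor eq (proj₁ rb refl) (proj₁ ra refl))
  notExactlyTwo-closed eq {true} {false} {true} ra rb rc = proj₂ rb (∈-product eq (proj₁ ra refl) (proj₁ rc refl))
  notExactlyTwo-closed eq {false} {true} {true} ra rb rc = proj₂ ra (∈-left-factor eq (proj₁ rb refl) (proj₁ rc refl))
  notExactlyTwo-closed eq {true} {true} {true} ra rb rc = refl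
  notExactlyTwo-closed eq {true} {false} {false} ra rb rc = refl
  notExactlyTwo-closed eq {false} {true} {false} ra rb rc = refl
  notExactlyTwo-closed eq {false} {false} {true} ra rb rc = refl
  notExactlyTwo-closed eq {false} {false} {false} ra rb rc = refl

module Covering {α : Set} (τ : α → α) (Hf : AlphaFamily τ) where
  open PiGroup τ
  open Projection τ
  open StepBrackets τ

  Kept : (N : Nanoword α) → Fin (n N) → Set
  Kept N X = _∈H (H Hf (label N X)) (bracket N X)

  kept-transport : (N N' : Nanoword α) (X : Fin (n N)) (B : Fin (n N')) → bracket N' B ≈ bracket N X → label N X ≡ label N' B →
                   (Kept N' B → Kept N X) × (Kept N X → Kept N' B)
  kept-transport N N' X B eq lab =
    (λ p → resp (H Hf (label N X)) eq (subst (λ a → _∈H (H Hf a) (bracket N' B)) (sym lab) p)) ,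
    (λ p → resp (H Hf (label N' B)) (π-sym eq) (subst (λ a → _∈H (H Hf a) (bracket N X)) lab p))

  kept-along : {N N' : Nanoword α} {d : Fin (n N) → Bool} {d' : Fin (n N') → Bool} → Represents d (Kept N) → Represents d' (Kept N') →
               (e : Fin (n N') → Fin (n N)) → (∀ B → label N (e B) ≡ label N' B) → (∀ B → bracket N' B ≈ bracket N (e B)) →
               ∀ B → d' B ≡ d (e B)
  kept-along {N} {N'} rep rep' e lab brackets B =
    represent-equivalent⇒≡ (rep' B) (rep (e B)) (proj₁ transport) (proj₂ transport)
    where transport = kept-transport N N' (e B) B (brackets B) (lab B)

  -- [A] = [B] and H_{|B|} = H_{τ|A|} = H_{|A|}.
  kept-move2 : (N : Nanoword α) (A B : Fin (n N)) (x y z : List (Fin (n N))) → word N ≡ x ++ A ∷ B ∷ y ++ B ∷ A ∷ z →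
               label N B ≡ τ (label N A) → Kept N A → Kept N B
  kept-move2 N A B x y z wEq lAB p =
    subst (λ u → _∈H (H Hf (label N B)) u) (bracket-move2-AB N A B x y z wEq)
      (subst (λ a → _∈H (H Hf a) (bracket N A)) (sym lAB) (H-τ Hf (label N A) _ p))

  kept-move2⁻ : (N : Nanoword α) (A B : Fin (n N)) (x y z : List (Fin (n N))) → word N ≡ x ++ A ∷ B ∷ y ++ B ∷ A ∷ z →
                label N B ≡ τ (label N A) → Kept N B → Kept N A
  kept-move2⁻ N A B x y z wEq lAB p =
    H-τ' Hf (label N A) _ (subst (λ a → _∈H (H Hf a) (bracket N A)) lAB
      (subst (λ u → _∈H (H Hf (label N B)) u) (sym (bracket-move2-AB N A B x y z wEq)) p))

  kept-move3 : (N : Nanoword α) (A B C : Fin (n N)) (x y z t : List (Fin (n N))) → (A≢B : A ≢ B) (A≢C : A ≢ C) (B≢C : B ≢ C) →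
               (lAB : label N A ≡ label N B) (lBC : label N B ≡ label N C) → word N ≡ move3-before x y z t A B C →
               {d : Fin (n N) → Bool} → Represents d (Kept N) → notExactlyTwo (d A) (d B) (d C) ≡ true
  kept-move3 N A B C x y z t A≢B A≢C B≢C lAB lBC wEq {d} rep =
    notExactlyTwo-closed (bracket-move3-B {N} A B C x y z t A≢B A≢C B≢C lAB lBC wEq) (inS A lAB) (inS B refl) (inS C (sym lBC))
    where
    open SubgroupProperties τ (H Hf (label N B)) using (notExactlyTwo-closed)
    inS : ∀ X → label N X ≡ label N B →
          (d X ≡ true → _∈H (H Hf (label N B)) (bracket N X)) × (_∈H (H Hf (label N B)) (bracket N X) → d X ≡ true)
    inS X l = (λ p → subst (λ a → _∈H (H Hf a) (bracket N X)) l (proj₁ (rep X) p)) ,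
              (λ q → proj₂ (rep X) (subst (λ a → _∈H (H Hf a) (bracket N X)) (sym l) q))

  kept-compatible : {N N' : Nanoword α} (s : Step τ N N') (d : Fin (n N) → Bool) (d' : Fin (n N') → Bool) →
                    Represents d (Kept N) → Represents d' (Kept N') → Compatible s d d'
  kept-compatible {N} {N'} (iso I@(e , _ , _ , lab , _)) d d' rep rep' =
    kept-along {N} {N'} rep rep' e lab (bracket-iso {N} {N'} I)
  kept-compatible {N} {N'} (move1 A x y wEq r@(e , _ , lab , _)) d d' rep rep' =
    kept-along {N} {N'} rep rep' e lab (bracket-move1 {N} {N'} A x y wEq r)
  kept-compatible {N} {N'} (move2 A B x y z wEq lAB r@(e , _ , lab , _)) d d' rep rep' =
    kept-along {N} {N'} rep rep' e lab (bracket-move2 {N} {N'} A B x y z wEq lAB r) ,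
    represent-equivalent⇒≡ (rep A) (rep B) (kept-move2 N A B x y z wEq lAB) (kept-move2⁻ N A B x y z wEq lAB)
  kept-compatible {N} {N'} (move3 A B C x y z t A≢B A≢C B≢C lAB lBC wEq e inj onto lab we) d d' rep rep' =
    kept-along {N} {N'} rep rep' e lab (bracket-move3 {N} A B C x y z t A≢B A≢C B≢C lAB lBC wEq {N'} e inj onto lab we) ,
    kept-move3 N A B C x y z t A≢B A≢C B≢C lAB lBC wEq rep

lemma5p1 : {α : Set} (τ : α → α) → (∀ a → τ (τ a) ≡ a) →
           (Hf : AlphaFamily τ) (N N' C C' : Nanoword α) →
           Homotopic τ N N' → IsCovering τ Hf N C → IsCovering τ Hf N' C' →
           Homotopic τ C C'
lemma5p1 τ _ Hf N N' C C' =
  ProjectionAlongHomotopy.restrictions-homotopic τ (Covering.Kept τ Hf) (Covering.kept-compatible τ Hf)
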